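{- If $n\geq5$, then there is a Cayley graph on the symmetric group $\mathrm{Sym}(n)$ with Cayley index $2$ whose automorphism group contains a regular subgroup isomorphic to $\mathrm{Alt}(n)\times\mathbb{Z}_2$.
   Context: For a group $G$ and $S\subseteq G\setminus\{1\}$, $\mathrm{Cay}(G,S)$ has vertex set $G$ and arcs $(u,v)$ whenever $vu^{ -1}\in S$; it is a Cayley graph when $S=S^{ -1}$ (so arcs are symmetric). $G$ acts on it by right multiplication and the Cayley index is $|\mathrm{Aut}(\mathrm{Cay}(G,S)):G|$, where $\mathrm{Aut}$ is the group of arc-preserving vertex permutations. A subgroup is regular if it acts regularly on the vertex set. -}

module Defs where

open import Data.Nat using (ℕ; _+_; _*_)
open import Data.Fin using (Fin)
open import Data.Fin.Permutation
  using (Permutation′; _⟨$⟩ʳ_; _∘ₚ_; transpose; flip)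
  renaming (id to idₚ; _≈_ to _≈ₚ_)
open import Data.Bool using (Bool; _xor_)
open import Data.List using (List; []; _∷_; length)
open import Data.List.Relation.Unary.Any using (Any)
open import Data.List.Relation.Unary.All using (All)
open import Data.List.Relation.Unary.AllPairs using (AllPairs)
open import Data.Product using (Σ; Σ-syntax; _×_; _,_; proj₁; proj₂)
open import Relation.Nullary using (¬_)
open import Relation.Binary.PropositionalEquality using (_≡_; _≢_)

-- The symmetric group Sym(n): permutations of Fin n (stdlib), with
-- pointwise equality _≈ₚ_.  Product: (σ · τ) i = σ (τ i).

Sym : ℕ → Set
Sym n = Permutation′ n

infixl 7 _·_
_·_ : {n : ℕ} → Sym n → Sym n → Sym n
σ · τ = τ ∘ₚ σ

e : {n : ℕ} → Sym n
e = idₚ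

infix 8 _⁻¹
_⁻¹ : {n : ℕ} → Sym n → Sym n
σ ⁻¹ = flip σ

Transposition : ℕ → Set
Transposition n = Σ (Fin n × Fin n) (λ p → proj₁ p ≢ proj₂ p)

prodT : {n : ℕ} → List (Transposition n) → Sym n
prodT []                    = e
prodT (((i , j) , _) ∷ ts)  = transpose i j · prodT ts

IsEven : {n : ℕ} → Sym n → Set
IsEven {n} σ = Σ[ ts ∈ List (Transposition n) ]
  (Σ[ k ∈ ℕ ] length ts ≡ k + k) × (prodT ts ≈ₚ σ)

HasSize : (A : Set) → (A → A → Set) → ℕ → Set
HasSize A _≈_ m = Σ[ L ∈ List A ]
  (length L ≡ m) × AllPairs (λ x y → ¬ (x ≈ y)) L × (∀ a → Any (λ x → a ≈ x) L)

Arc : {n : ℕ} → List (Sym n) → Sym n → Sym n → Set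
Arc S u v = Any (λ s → (v · u ⁻¹) ≈ₚ s) S

_∈S_ : {n : ℕ} → Sym n → List (Sym n) → Set
σ ∈S S = Any (λ s → σ ≈ₚ s) S

IsCayleySet : {n : ℕ} → List (Sym n) → Set
IsCayleySet S = ¬ (e ∈S S) × All (λ s → (s ⁻¹) ∈S S) S

record Aut (n : ℕ) (S : List (Sym n)) : Set where
  field
    f      : Sym n → Sym n
    g      : Sym n → Sym n
    f-cong : ∀ {u v} → u ≈ₚ v → f u ≈ₚ f v
    g-cong : ∀ {u v} → u ≈ₚ v → g u ≈ₚ g v
    gf     : ∀ u → g (f u) ≈ₚ u
    fg     : ∀ u → f (g u) ≈ₚ u
    arc→   : ∀ u v → Arc S u v → Arc S (f u) (f v)
    arc←   : ∀ u v → Arc S (f u) (f v) → Arc S u v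

open Aut public

_≈A_ : {n : ℕ} {S : List (Sym n)} → Aut n S → Aut n S → Set
α ≈A β = ∀ u → f α u ≈ₚ f β u

CayleyIndex : {n : ℕ} → List (Sym n) → ℕ → Set
CayleyIndex {n} S k = Σ[ m ∈ ℕ ] HasSize (Sym n) _≈ₚ_ m × HasSize (Aut n S) _≈A_ (k * m)

record RegularAltZ2 (n : ℕ) (S : List (Sym n)) : Set where
  field
    φ      : (a : Sym n) → IsEven a → Bool → Aut n S
    φ-cong : ∀ a a' pa pa' x → a ≈ₚ a' → φ a pa x ≈A φ a' pa' x
    φ-hom  : ∀ a b pa pb x y (pab : IsEven (a · b)) →
             ∀ u → f (φ (a · b) pab (x xor y)) u ≈ₚ f (φ a pa x) (f (φ b pb y) u)
    φ-inj  : ∀ a b pa pb x y → φ a pa x ≈A φ b pb y → (a ≈ₚ b) × (x ≡ y)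
    transitive : ∀ u v → Σ[ a ∈ Sym n ] Σ[ pa ∈ IsEven a ] Σ[ x ∈ Bool ]
                   f (φ a pa x) u ≈ₚ v
    semiregular : ∀ u a b pa pb x y → f (φ a pa x) u ≈ₚ f (φ b pb y) u →
                   (a ≈ₚ b) × (x ≡ y)

module Submission where

-- Let T be the tree on {0, …, n - 1} with edges {0, 2}, {1, 2}, {2, 3}, {3, 4}, …, {n - 2, n - 1}, and let S
-- consist of its edges read as transpositions. Right translations u ↦ u h and the left multiplication by
-- t = (0 1), which swaps the first two edges, are automorphisms of Cay(Sym n, S); we show that every
-- automorphism is u ↦ tˣ u h. An automorphism fixing e permutes the neighbours E i of e, and two of them have
-- a second common neighbour (lie on a square through e) iff their edges are disjoint, so it induces an
-- automorphism of the line graph of T. For n ≥ 5 that graph is a triangle with a tail, so this is the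
-- identity or the swap of the edges {0, 2} and {1, 2}; composing with u ↦ t u t we may assume it fixes S
-- pointwise. Conjugating by right translations, it then fixes every E j E k (for k = 2 because of the hexagon
-- E 2 E 0 E 2 = E 0 E 2 E 0), hence every word in S, hence everything. So Aut has 2 · n! elements, and the
-- maps u ↦ tˣ u a⁻¹ with a even form a regular subgroup ≅ Alt(n) × Z₂: some x makes v⁻¹ tˣ u even, and
-- tˣ u a⁻¹ = tʸ u b⁻¹ forces x = y because t is odd.

open import Defs
open import Data.Bool using (Bool; true; false; not; _∧_; _xor_)
open import Data.Bool.Properties
  using (∧-zeroʳ; xor-identityʳ; not-involutive; not-distribˡ-xor; not-¬)
open import Data.Bool.Solver using (module xor-∧-Solver)
open import Data.Empty using (⊥; ⊥-elim)
open import Data.Fin using (Fin; zero; suc; toℕ; fromℕ<; inject₁; punchIn)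
open import Data.Fin.Patterns using (0F; 1F; 2F; 3F)
open import Data.Fin.Properties
  using (_≟_; _<?_; <-cmp; toℕ-injective; toℕ-fromℕ<; fromℕ<-toℕ; toℕ<n; toℕ-inject₁; punchIn-injective)
open import Data.Fin.Permutation
  using (_⟨$⟩ʳ_; _⟨$⟩ˡ_; _≈_; transpose; inverseˡ; inverseʳ; insert; remove; insert-remove; insert-punchIn)
open import Data.Fin.Permutation.Transposition.List using (TranspositionList; eval; decompose; eval-decompose)
open import Data.List using (List; []; _∷_; map; allFin; _++_; [_]; length)
open import Data.List.Properties using (map-∘; map-cong; map-id; length-++; length-map)
open import Data.List.Membership.Propositional using (_∈_; _∉_)
open import Data.List.Membership.Propositional.Properties using (∈-allFin; ∈-map⁺)
open import Data.List.Relation.Unary.All as All using (All; []; _∷_)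
import Data.List.Relation.Unary.All.Properties as All
open import Data.List.Relation.Unary.Any as Any using (Any; here; there; satisfied)
import Data.List.Relation.Unary.Any.Properties as Any
open import Data.List.Relation.Unary.AllPairs as AllPairs using (AllPairs; []; _∷_)
import Data.List.Relation.Unary.AllPairs.Properties as AllPairs
open import Data.List.Relation.Unary.Unique.Propositional using (Unique)
import Data.List.Relation.Unary.Unique.Propositional.Properties as Unique
open import Data.Nat using (ℕ; zero; suc; _+_; _*_; _≤_; _<_; z≤n; s≤s; s≤s⁻¹; s<s⁻¹; _≤?_)
import Data.Nat.Properties as ℕ
open import Data.Product using (Σ; Σ-syntax; ∃; _×_; _,_; proj₁; proj₂)
open import Data.Sum using (_⊎_; inj₁; inj₂)
import Data.Sum as Sum
open import Function using (_∘_; _$_; id)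
open import Function.Bundles using (mk⇔)
open import Relation.Binary.Definitions using (Tri; tri<; tri≈; tri>)
open import Relation.Binary.PropositionalEquality
  using (_≡_; _≢_; refl; sym; trans; cong; cong₂; subst; subst₂; ≢-sym; module ≡-Reasoning)
open import Relation.Nullary using (¬_; Dec; yes; no)
open import Relation.Nullary.Decidable using (does; dec-true; dec-false; does-⇔; _⊎-dec_)

-- Transpositions

module _ {n : ℕ} where

  ⟨$⟩ʳ-injective : (σ : Sym n) {i j : Fin n} → σ ⟨$⟩ʳ i ≡ σ ⟨$⟩ʳ j → i ≡ j
  ⟨$⟩ʳ-injective σ {i} {j} eq = begin
    i                  ≡⟨ inverseˡ σ ⟨
    σ ⟨$⟩ˡ (σ ⟨$⟩ʳ i)  ≡⟨ cong (σ ⟨$⟩ˡ_) eq ⟩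
    σ ⟨$⟩ˡ (σ ⟨$⟩ʳ j)  ≡⟨ inverseˡ σ ⟩
    j                  ∎
    where open ≡-Reasoning

  ·-cancelˡ : (ρ : Sym n) {σ τ : Sym n} → ρ · σ ≈ ρ · τ → σ ≈ τ
  ·-cancelˡ ρ eq i = ⟨$⟩ʳ-injective ρ (eq i)

  ·-cancelʳ : (ρ : Sym n) {σ τ : Sym n} → σ · ρ ≈ τ · ρ → σ ≈ τ
  ·-cancelʳ ρ {σ} {τ} eq i = begin
    σ ⟨$⟩ʳ i                  ≡⟨ cong (σ ⟨$⟩ʳ_) (inverseʳ ρ) ⟨
    σ ⟨$⟩ʳ (ρ ⟨$⟩ʳ (ρ ⟨$⟩ˡ i)) ≡⟨ eq (ρ ⟨$⟩ˡ i) ⟩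
    τ ⟨$⟩ʳ (ρ ⟨$⟩ʳ (ρ ⟨$⟩ˡ i)) ≡⟨ cong (τ ⟨$⟩ʳ_) (inverseʳ ρ) ⟩
    τ ⟨$⟩ʳ i                  ∎
    where open ≡-Reasoning

  ⁻¹-cong : {σ τ : Sym n} → σ ≈ τ → σ ⁻¹ ≈ τ ⁻¹
  ⁻¹-cong {σ} {τ} eq i = ⟨$⟩ʳ-injective τ (begin
    τ ⟨$⟩ʳ (σ ⟨$⟩ˡ i)   ≡⟨ eq (σ ⟨$⟩ˡ i) ⟨
    σ ⟨$⟩ʳ (σ ⟨$⟩ˡ i)   ≡⟨ inverseʳ σ ⟩
    i                   ≡⟨ inverseʳ τ ⟨
    τ ⟨$⟩ʳ (τ ⟨$⟩ˡ i)   ∎)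
    where open ≡-Reasoning

  ·⁻¹≈⇒≈· : {σ τ h : Sym n} → σ · h ⁻¹ ≈ τ → σ ≈ τ · h
  ·⁻¹≈⇒≈· {σ} {τ} {h} eq x = trans (cong (σ ⟨$⟩ʳ_) (sym (inverseˡ h))) (eq (h ⟨$⟩ʳ x))

  ≈·⇒·⁻¹≈ : {σ τ h : Sym n} → σ ≈ τ · h → σ · h ⁻¹ ≈ τ
  ≈·⇒·⁻¹≈ {σ} {τ} {h} eq x = trans (eq (h ⟨$⟩ˡ x)) (cong (τ ⟨$⟩ʳ_) (inverseʳ h))

  quotient-inverse : {a v w : Sym n} → a ≈ v ⁻¹ · w → w · a ⁻¹ ≈ v
  quotient-inverse {a} {v} {w} a≈v⁻¹w = ·-cancelʳ a {w · a ⁻¹} {v} λ x →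
    trans (cong (w ⟨$⟩ʳ_) (inverseˡ a)) (sym (trans (cong (v ⟨$⟩ʳ_) (a≈v⁻¹w x)) (inverseʳ v)))

  transpose-fromˡ : (i j : Fin n) → transpose i j ⟨$⟩ʳ i ≡ j
  transpose-fromˡ i j with i ≟ i
  ... | yes _ = refl
  ... | no i≢i = ⊥-elim (i≢i refl)

  transpose-fromʳ : (i j : Fin n) → transpose i j ⟨$⟩ʳ j ≡ i
  transpose-fromʳ i j with j ≟ i
  ... | yes j≡i = j≡i
  ... | no _ with j ≟ j
  ...   | yes _ = refl
  ...   | no j≢j = ⊥-elim (j≢j refl)

  transpose-fix : {i j k : Fin n} → k ≢ i → k ≢ j → transpose i j ⟨$⟩ʳ k ≡ k
  transpose-fix {i} {j} {k} k≢i k≢j with k ≟ i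
  ... | yes k≡i = ⊥-elim (k≢i k≡i)
  ... | no _ with k ≟ j
  ...   | yes k≡j = ⊥-elim (k≢j k≡j)
  ...   | no _ = refl

  data TransposeView (i j k : Fin n) : Set where
    at-i  : k ≡ i → transpose i j ⟨$⟩ʳ k ≡ j → TransposeView i j k
    at-j  : k ≡ j → transpose i j ⟨$⟩ʳ k ≡ i → TransposeView i j k
    fixed : k ≢ i → k ≢ j → transpose i j ⟨$⟩ʳ k ≡ k → TransposeView i j k

  transpose-view : (i j k : Fin n) → TransposeView i j k
  transpose-view i j k with k ≟ i
  ... | yes refl = at-i refl (transpose-fromˡ i j)
  ... | no k≢i with k ≟ j
  ...   | yes refl = at-j refl (transpose-fromʳ i j)
  ...   | no k≢j = fixed k≢i k≢j (transpose-fix k≢i k≢j)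

  transpose-comm : (i j : Fin n) → transpose i j ≈ transpose j i
  transpose-comm i j k with transpose-view i j k
  ... | at-i refl eq = trans eq (sym (transpose-fromʳ j i))
  ... | at-j refl eq = trans eq (sym (transpose-fromˡ j i))
  ... | fixed k≢i k≢j eq = trans eq (sym (transpose-fix k≢j k≢i))

  transpose-involutive : (i j : Fin n) → transpose i j · transpose i j ≈ e
  transpose-involutive i j k with transpose-view i j k
  ... | at-i refl eq = trans (cong (transpose i j ⟨$⟩ʳ_) eq) (transpose-fromʳ i j)
  ... | at-j refl eq = trans (cong (transpose i j ⟨$⟩ʳ_) eq) (transpose-fromˡ i j)
  ... | fixed _ _ eq = trans (cong (transpose i j ⟨$⟩ʳ_) eq) eq

  transpose-self : (i : Fin n) → transpose i i ≈ e
  transpose-self i k with transpose-view i i k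
  ... | at-i refl eq = eq
  ... | at-j refl eq = eq
  ... | fixed _ _ eq = eq

  transpose-conj : (σ : Sym n) (i j : Fin n) →
                   σ · transpose i j ≈ transpose (σ ⟨$⟩ʳ i) (σ ⟨$⟩ʳ j) · σ
  transpose-conj σ i j k with transpose-view i j k
  ... | at-i refl eq = trans (cong (σ ⟨$⟩ʳ_) eq) (sym (transpose-fromˡ (σ ⟨$⟩ʳ i) (σ ⟨$⟩ʳ j)))
  ... | at-j refl eq = trans (cong (σ ⟨$⟩ʳ_) eq) (sym (transpose-fromʳ (σ ⟨$⟩ʳ i) (σ ⟨$⟩ʳ j)))
  ... | fixed k≢i k≢j eq = trans (cong (σ ⟨$⟩ʳ_) eq)
    (sym (transpose-fix (λ p → k≢i (⟨$⟩ʳ-injective σ p)) (λ p → k≢j (⟨$⟩ʳ-injective σ p))))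

  SamePair : Fin n → Fin n → Fin n → Fin n → Set
  SamePair i j k l = (i ≡ k × j ≡ l) ⊎ (i ≡ l × j ≡ k)

  samePair-swap : {i j k l : Fin n} → SamePair i j k l → SamePair i j l k
  samePair-swap (inj₁ (i≡k , j≡l)) = inj₂ (i≡k , j≡l)
  samePair-swap (inj₂ (i≡l , j≡k)) = inj₁ (i≡l , j≡k)

  samePair-sym : {i j k l : Fin n} → SamePair i j k l → SamePair k l i j
  samePair-sym (inj₁ (i≡k , j≡l)) = inj₁ (sym i≡k , sym j≡l)
  samePair-sym (inj₂ (i≡l , j≡k)) = inj₂ (sym j≡k , sym i≡l)

  samePair-other : {p q u v w : Fin n} → SamePair p q u v → SamePair p q u w → u ≢ v → v ≡ w
  samePair-other (inj₁ (refl , refl)) (inj₁ (_ , refl))   _   = refl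
  samePair-other (inj₁ (refl , refl)) (inj₂ (_ , q≡u))    u≢v = ⊥-elim (u≢v (sym q≡u))
  samePair-other (inj₂ (refl , refl)) (inj₁ (p≡u , _))    u≢v = ⊥-elim (u≢v (sym p≡u))
  samePair-other (inj₂ (refl , refl)) (inj₂ (p≡w , _))    _   = p≡w

  transpose-cong : {i j k l : Fin n} → SamePair i j k l → transpose i j ≈ transpose k l
  transpose-cong (inj₁ (refl , refl)) _ = refl
  transpose-cong (inj₂ (refl , refl)) = transpose-comm _ _

  transpose-conj-transpose : {i j k : Fin n} → i ≢ j → i ≢ k →
                             transpose j k · transpose i j · transpose j k ≈ transpose i k
  transpose-conj-transpose {i} {j} {k} i≢j i≢k x = begin
    τ ⟨$⟩ʳ (transpose i j ⟨$⟩ʳ (τ ⟨$⟩ʳ x))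
      ≡⟨ transpose-conj τ i j (τ ⟨$⟩ʳ x) ⟩
    transpose (τ ⟨$⟩ʳ i) (τ ⟨$⟩ʳ j) ⟨$⟩ʳ (τ ⟨$⟩ʳ (τ ⟨$⟩ʳ x))
      ≡⟨ transpose-cong (inj₁ (transpose-fix i≢j i≢k , transpose-fromˡ j k)) (τ ⟨$⟩ʳ (τ ⟨$⟩ʳ x)) ⟩
    transpose i k ⟨$⟩ʳ (τ ⟨$⟩ʳ (τ ⟨$⟩ʳ x))
      ≡⟨ cong (transpose i k ⟨$⟩ʳ_) (transpose-involutive j k x) ⟩
    transpose i k ⟨$⟩ʳ x ∎
    where
    open ≡-Reasoning
    τ = transpose j k

  transpose-moves : {i j x y : Fin n} → transpose i j ⟨$⟩ʳ x ≡ y → x ≢ y → SamePair i j x y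
  transpose-moves {i} {j} {x} refl x≢y with transpose-view i j x
  ... | at-i x≡i eq = inj₁ (sym x≡i , sym eq)
  ... | at-j x≡j eq = inj₂ (sym eq , sym x≡j)
  ... | fixed _ _ eq = ⊥-elim (x≢y (sym eq))

  transpose-injective : {i j k l : Fin n} → i ≢ j → transpose i j ≈ transpose k l → SamePair i j k l
  transpose-injective {i} {j} i≢j eq =
    samePair-sym (transpose-moves (trans (sym (eq i)) (transpose-fromˡ i j)) i≢j)

  module _ {i j x y : Fin n} (same : SamePair i j x y) where

    transpose-sendsˡ : transpose i j ⟨$⟩ʳ x ≡ y
    transpose-sendsˡ = trans (transpose-cong same x) (transpose-fromˡ x y)

    transpose-sendsʳ : transpose i j ⟨$⟩ʳ y ≡ x
    transpose-sendsʳ = trans (transpose-cong same y) (transpose-fromʳ x y)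

    transpose-fixes : {w : Fin n} → w ≢ x → w ≢ y → transpose i j ⟨$⟩ʳ w ≡ w
    transpose-fixes {w} w≢x w≢y = trans (transpose-cong same w) (transpose-fix w≢x w≢y)

  transpose-reverse : {i j x y : Fin n} → transpose i j ⟨$⟩ʳ x ≡ y → transpose i j ⟨$⟩ʳ y ≡ x
  transpose-reverse {i} {j} {x} refl = transpose-involutive i j x

  factor-disjoint : {p q p′ q′ a b c d : Fin n} →
    a ≢ b → a ≢ c → a ≢ d → b ≢ c → b ≢ d → c ≢ d →
    transpose p q · transpose p′ q′ ≈ transpose a b · transpose c d →
    (SamePair p q a b × SamePair p′ q′ c d) ⊎ (SamePair p q c d × SamePair p′ q′ a b)
  factor-disjoint {p} {q} {p′} {q′} {a} {b} {c} {d} a≢b a≢c a≢d b≢c b≢d c≢d eq =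
    cases (Q ⟨$⟩ʳ a ≟ a) (Q ⟨$⟩ʳ a ≟ b)
    where
    P = transpose p q
    Q = transpose p′ q′
    a↦b : P ⟨$⟩ʳ (Q ⟨$⟩ʳ a) ≡ b
    a↦b = trans (eq a) (trans (cong (transpose a b ⟨$⟩ʳ_) (transpose-fix a≢c a≢d)) (transpose-fromˡ a b))
    b↦a : P ⟨$⟩ʳ (Q ⟨$⟩ʳ b) ≡ a
    b↦a = trans (eq b) (trans (cong (transpose a b ⟨$⟩ʳ_) (transpose-fix b≢c b≢d)) (transpose-fromʳ a b))
    c↦d : P ⟨$⟩ʳ (Q ⟨$⟩ʳ c) ≡ d
    c↦d = trans (eq c) (trans (cong (transpose a b ⟨$⟩ʳ_) (transpose-fromˡ c d))
                              (transpose-fix (≢-sym a≢d) (≢-sym b≢d)))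
    cases : Dec (Q ⟨$⟩ʳ a ≡ a) → Dec (Q ⟨$⟩ʳ a ≡ b) →
            (SamePair p q a b × SamePair p′ q′ c d) ⊎ (SamePair p q c d × SamePair p′ q′ a b)
    cases (yes Qa≡a) _ = inj₁ (sP , transpose-moves Qc≡d c≢d)
      where
      sP = transpose-moves (trans (cong (P ⟨$⟩ʳ_) (sym Qa≡a)) a↦b) a≢b
      Qc≡d = trans (sym (transpose-reverse c↦d)) (transpose-fixes sP (≢-sym a≢d) (≢-sym b≢d))
    cases (no _) (yes Qa≡b) = inj₂ (transpose-moves (trans (cong (P ⟨$⟩ʳ_) (sym Qc≡c)) c↦d) c≢d , sQ)
      where
      sQ = transpose-moves Qa≡b a≢b
      Qc≡c = transpose-fixes sQ (≢-sym a≢c) (≢-sym b≢c)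
    cases (no Qa≢a) (no Qa≢b) = ⊥-elim (Qa≢a (trans (sym (transpose-sendsʳ sP)) Pb≡a))
      where
      sP = transpose-moves a↦b Qa≢b
      sQ = transpose-moves {x = a} refl (≢-sym Qa≢a)
      Pb≡a = trans (cong (P ⟨$⟩ʳ_) (sym (transpose-fixes sQ (≢-sym a≢b) (λ b≡Qa → Qa≢b (sym b≡Qa))))) b↦a

  factor-three-cycle : {p q p′ q′ i j k : Fin n} → i ≢ j → j ≢ k → i ≢ k →
    transpose p′ q′ · transpose p q ≈ transpose j k · transpose i j →
    (SamePair p q i j × SamePair p′ q′ j k) ⊎
    (SamePair p q j k × SamePair p′ q′ k i) ⊎
    (SamePair p q k i × SamePair p′ q′ i j)
  factor-three-cycle {p} {q} {p′} {q′} {i} {j} {k} i≢j j≢k i≢k eq =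
    cases (P ⟨$⟩ʳ i ≟ i) (P ⟨$⟩ʳ i ≟ k)
    where
    P = transpose p q
    Q = transpose p′ q′
    i↦k : Q ⟨$⟩ʳ (P ⟨$⟩ʳ i) ≡ k
    i↦k = trans (eq i) (trans (cong (transpose j k ⟨$⟩ʳ_) (transpose-fromˡ i j)) (transpose-fromˡ j k))
    j↦i : Q ⟨$⟩ʳ (P ⟨$⟩ʳ j) ≡ i
    j↦i = trans (eq j) (trans (cong (transpose j k ⟨$⟩ʳ_) (transpose-fromʳ i j)) (transpose-fix i≢j i≢k))
    k↦j : Q ⟨$⟩ʳ (P ⟨$⟩ʳ k) ≡ j
    k↦j = trans (eq k) (trans (cong (transpose j k ⟨$⟩ʳ_) (transpose-fix (≢-sym i≢k) (≢-sym j≢k)))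
                              (transpose-fromʳ j k))
    cases : Dec (P ⟨$⟩ʳ i ≡ i) → Dec (P ⟨$⟩ʳ i ≡ k) →
            (SamePair p q i j × SamePair p′ q′ j k) ⊎
            (SamePair p q j k × SamePair p′ q′ k i) ⊎
            (SamePair p q k i × SamePair p′ q′ i j)
    cases (yes Pi≡i) _ = inj₂ (inj₁ (transpose-moves Pj≡k j≢k , samePair-swap sQ))
      where
      sQ = transpose-moves (trans (cong (Q ⟨$⟩ʳ_) (sym Pi≡i)) i↦k) i≢k
      Pj≡k = trans (sym (transpose-reverse j↦i)) (transpose-sendsˡ sQ)
    cases (no _) (yes Pi≡k) = inj₂ (inj₂ (samePair-swap sP , transpose-moves Qi≡j i≢j))
      where
      sP = transpose-moves Pi≡k i≢k
      Qi≡j = trans (cong (Q ⟨$⟩ʳ_) (sym (transpose-sendsʳ sP))) k↦j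
    cases (no Pi≢i) (no Pi≢k) = middle (P ⟨$⟩ʳ i ≟ j)
      where
      sP = transpose-moves {x = i} refl (≢-sym Pi≢i)
      sQ = transpose-moves i↦k Pi≢k
      middle : Dec (P ⟨$⟩ʳ i ≡ j) →
               (SamePair p q i j × SamePair p′ q′ j k) ⊎
               (SamePair p q j k × SamePair p′ q′ k i) ⊎
               (SamePair p q k i × SamePair p′ q′ i j)
      middle (yes refl) = inj₁ (sP , sQ)
      middle (no Pi≢j) = ⊥-elim (i≢j (trans (sym j↦i) Qj≡j))
        where
        Pj≡j = transpose-fixes sP (≢-sym i≢j) (λ j≡Pi → Pi≢j (sym j≡Pi))
        Qj≡j = trans (cong (Q ⟨$⟩ʳ_) Pj≡j) (transpose-fixes sQ (λ j≡Pi → Pi≢j (sym j≡Pi)) j≢k)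

-- The parity of a permutation

open xor-∧-Solver using (solve; _:=_; _:+_; _:*_)

xor-interchange : (a b c d : Bool) → (a xor b) xor (c xor d) ≡ (a xor c) xor (b xor d)
xor-interchange = solve 4 (λ a b c d → (a :+ b) :+ (c :+ d) := (a :+ c) :+ (b :+ d)) refl

xor≡false⇒≡ : (a b : Bool) → a xor b ≡ false → a ≡ b
xor≡false⇒≡ false false _ = refl
xor≡false⇒≡ true  true  _ = refl

xor-true : (a : Bool) → a xor true ≡ not a
xor-true false = refl
xor-true true  = refl

halves : (m : ℕ) → (Σ[ k ∈ ℕ ] m ≡ k + k) ⊎ (Σ[ k ∈ ℕ ] suc m ≡ k + k)
halves zero    = inj₁ (0 , refl)
halves (suc m) with halves m
... | inj₁ (k , m≡k+k)   = inj₂ (suc k , cong suc (trans (cong suc m≡k+k) (sym (ℕ.+-suc k k))))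
... | inj₂ (k , 1+m≡k+k) = inj₁ (k , 1+m≡k+k)

xorSum : List Bool → Bool
xorSum []       = false
xorSum (b ∷ bs) = b xor xorSum bs

module _ {A : Set} where

  xorSum-map-xor : (f g : A → Bool) (xs : List A) →
                   xorSum (map (λ x → f x xor g x) xs) ≡ xorSum (map f xs) xor xorSum (map g xs)
  xorSum-map-xor f g []       = refl
  xorSum-map-xor f g (x ∷ xs) = trans (cong ((f x xor g x) xor_) (xorSum-map-xor f g xs))
    (xor-interchange (f x) (g x) _ _)

  xorSum-map-∧ : (b : Bool) (f : A → Bool) (xs : List A) →
                 xorSum (map (λ x → b ∧ f x) xs) ≡ b ∧ xorSum (map f xs)
  xorSum-map-∧ b f []       = sym (∧-zeroʳ b)
  xorSum-map-∧ b f (x ∷ xs) = trans (cong ((b ∧ f x) xor_) (xorSum-map-∧ b f xs))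
    (solve 3 (λ b c d → b :* c :+ b :* d := b :* (c :+ d)) refl b (f x) _)

  xorSum-map-cong : {f g : A → Bool} {xs : List A} → All (λ x → f x ≡ g x) xs →
                    xorSum (map f xs) ≡ xorSum (map g xs)
  xorSum-map-cong []         = refl
  xorSum-map-cong (eq ∷ eqs) = cong₂ _xor_ eq (xorSum-map-cong eqs)

  pairParity : (A → A → Bool) → List A → Bool
  pairParity R []       = false
  pairParity R (x ∷ xs) = xorSum (map (R x) xs) xor pairParity R xs

  pairParity-xor : (R R′ : A → A → Bool) (xs : List A) →
    pairParity (λ x y → R x y xor R′ x y) xs ≡ pairParity R xs xor pairParity R′ xs
  pairParity-xor R R′ []       = refl
  pairParity-xor R R′ (x ∷ xs) =
    trans (cong₂ _xor_ (xorSum-map-xor (R x) (R′ x) xs) (pairParity-xor R R′ xs))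
      (xor-interchange (xorSum (map (R x) xs)) (xorSum (map (R′ x) xs)) _ _)

  pairParity-cong : {R R′ : A → A → Bool} {xs : List A} →
    AllPairs (λ x y → R x y ≡ R′ x y) xs → pairParity R xs ≡ pairParity R′ xs
  pairParity-cong []         = refl
  pairParity-cong (eq ∷ eqs) = cong₂ _xor_ (xorSum-map-cong eq) (pairParity-cong eqs)

  pairParity-map : (R : A → A → Bool) (s : A → A) (xs : List A) →
    pairParity R (map s xs) ≡ pairParity (λ x y → R (s x) (s y)) xs
  pairParity-map R s []       = refl
  pairParity-map R s (x ∷ xs) =
    cong₂ _xor_ (cong xorSum (sym (map-∘ xs))) (pairParity-map R s xs)

  pairParity-false : (xs : List A) → pairParity (λ _ _ → false) xs ≡ false
  pairParity-false []       = refl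
  pairParity-false (x ∷ xs) = cong₂ _xor_ (xorSum-false xs) (pairParity-false xs)
    where
    xorSum-false : (ys : List A) → xorSum (map (λ _ → false) ys) ≡ false
    xorSum-false []       = refl
    xorSum-false (_ ∷ ys) = xorSum-false ys

module _ {n : ℕ} where

  occurs : Fin n → List (Fin n) → Bool
  occurs v xs = xorSum (map (λ x → does (x ≟ v)) xs)

  occurs-∉ : {v : Fin n} {xs : List (Fin n)} → v ∉ xs → occurs v xs ≡ false
  occurs-∉ {xs = []}     v∉xs = refl
  occurs-∉ {xs = x ∷ xs} v∉xs =
    cong₂ _xor_ (dec-false (x ≟ _) (λ x≡v → v∉xs (here (sym x≡v)))) (occurs-∉ (v∉xs ∘ there))

  occurs-unique : {v : Fin n} {xs : List (Fin n)} → Unique xs → v ∈ xs → occurs v xs ≡ true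
  occurs-unique {v} (x∉xs ∷ _) (here refl) =
    cong₂ _xor_ (dec-true (v ≟ v) refl) (occurs-∉ (All.All¬⇒¬Any x∉xs))
  occurs-unique {v} {x ∷ xs} (x∉xs ∷ xs!) (there v∈xs) =
    cong₂ _xor_ (dec-false (x ≟ v) (λ { refl → All.All¬⇒¬Any x∉xs v∈xs })) (occurs-unique xs! v∈xs)

  inversions : List (Fin n) → Bool
  inversions = pairParity (λ x y → does (y <? x))

  values : Sym n → List (Fin n)
  values σ = map (σ ⟨$⟩ʳ_) (allFin n)

  values-unique : (σ : Sym n) → Unique (values σ)
  values-unique σ = Unique.map⁺ (⟨$⟩ʳ-injective σ) (Unique.allFin⁺ n)

  ∈-values : (σ : Sym n) (v : Fin n) → v ∈ values σ
  ∈-values σ v = subst (_∈ values σ) (inverseʳ σ) (∈-map⁺ (σ ⟨$⟩ʳ_) (∈-allFin (σ ⟨$⟩ˡ v)))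

  -- true for odd permutations
  parity : Sym n → Bool
  parity σ = inversions (values σ)

  parity-cong : {σ τ : Sym n} → σ ≈ τ → parity σ ≡ parity τ
  parity-cong σ≈τ = cong inversions (map-cong σ≈τ (allFin n))

  module Adjacent {k k′ : Fin n} (k′≡1+k : toℕ k′ ≡ suc (toℕ k)) where

    private
      s : Fin n → Fin n
      s = transpose k k′ ⟨$⟩ʳ_

    k<k′ : toℕ k < toℕ k′
    k<k′ = subst (toℕ k <_) (sym k′≡1+k) (ℕ.n<1+n (toℕ k))

    k≢k′ : k ≢ k′
    k≢k′ k≡k′ = ℕ.<-irrefl (cong toℕ k≡k′) k<k′

    isPair : Fin n → Fin n → Bool
    isPair x y = (does (x ≟ k) ∧ does (y ≟ k′)) xor (does (x ≟ k′) ∧ does (y ≟ k))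

    <k′⇒<k : {x : Fin n} → x ≢ k → toℕ x < toℕ k′ → toℕ x < toℕ k
    <k′⇒<k {x} x≢k x<k′ with ℕ.m<1+n⇒m<n∨m≡n (subst (toℕ x <_) k′≡1+k x<k′)
    ... | inj₁ x<k = x<k
    ... | inj₂ x≡k = ⊥-elim (x≢k (toℕ-injective x≡k))

    k<⇒k′< : {x : Fin n} → x ≢ k′ → toℕ k < toℕ x → toℕ k′ < toℕ x
    k<⇒k′< {x} x≢k′ k<x = subst (_< toℕ x) (sym k′≡1+k)
      (ℕ.≤∧≢⇒< k<x (λ 1+k≡x → x≢k′ (toℕ-injective (trans (sym 1+k≡x) (sym k′≡1+k)))))

    same-order : {a b c d : Fin n} → (toℕ a < toℕ b → toℕ c < toℕ d) → (toℕ c < toℕ d → toℕ a < toℕ b) →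
                 does (a <? b) ≡ does (c <? d) xor false
    same-order to from = trans (does-⇔ (mk⇔ to from) (_ <? _) (_ <? _)) (sym (xor-identityʳ _))

    order-flip : {x y : Fin n} → x ≢ y → does (s y <? s x) ≡ does (y <? x) xor isPair x y
    order-flip {x} {y} x≢y with transpose-view k k′ x | transpose-view k k′ y
    ... | at-i refl _ | at-i refl _ = ⊥-elim (x≢y refl)
    ... | at-j refl _ | at-j refl _ = ⊥-elim (x≢y refl)
    ... | at-i refl sx | at-j refl sy
      rewrite sx | sy | dec-true (k <? k′) k<k′ | dec-false (k′ <? k) (ℕ.<-asym k<k′)
            | dec-true (k ≟ k) refl | dec-true (k′ ≟ k′) refl
            | dec-false (k ≟ k′) k≢k′ | dec-false (k′ ≟ k) (≢-sym k≢k′) = refl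
    ... | at-j refl sx | at-i refl sy
      rewrite sx | sy | dec-true (k <? k′) k<k′ | dec-false (k′ <? k) (ℕ.<-asym k<k′)
            | dec-true (k ≟ k) refl | dec-true (k′ ≟ k′) refl
            | dec-false (k ≟ k′) k≢k′ | dec-false (k′ ≟ k) (≢-sym k≢k′) = refl
    ... | at-i refl sx | fixed y≢k y≢k′ sy
      rewrite sx | sy | dec-true (k ≟ k) refl | dec-false (y ≟ k′) y≢k′ | dec-false (k ≟ k′) k≢k′ =
        same-order (<k′⇒<k y≢k) (λ y<k → ℕ.<-trans y<k k<k′)
    ... | at-j refl sx | fixed y≢k y≢k′ sy
      rewrite sx | sy | dec-true (k′ ≟ k′) refl | dec-false (y ≟ k) y≢k | dec-false (k′ ≟ k) (≢-sym k≢k′) =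
        same-order (λ y<k → ℕ.<-trans y<k k<k′) (<k′⇒<k y≢k)
    ... | fixed x≢k x≢k′ sx | at-i refl sy
      rewrite sx | sy | dec-false (x ≟ k) x≢k | dec-false (x ≟ k′) x≢k′ =
        same-order (ℕ.<-trans k<k′) (k<⇒k′< x≢k′)
    ... | fixed x≢k x≢k′ sx | at-j refl sy
      rewrite sx | sy | dec-false (x ≟ k) x≢k | dec-false (x ≟ k′) x≢k′ =
        same-order (k<⇒k′< x≢k′) (ℕ.<-trans k<k′)
    ... | fixed x≢k x≢k′ sx | fixed y≢k y≢k′ sy
      rewrite sx | sy | dec-false (x ≟ k) x≢k | dec-false (x ≟ k′) x≢k′ = sym (xor-identityʳ _)

    pairParity-isPair : (xs : List (Fin n)) → pairParity isPair xs ≡ occurs k xs ∧ occurs k′ xs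
    pairParity-isPair []       = refl
    pairParity-isPair (x ∷ xs) = begin
      xorSum (map (isPair x) xs) xor pairParity isPair xs
        ≡⟨ cong₂ _xor_ (trans (xorSum-map-xor _ _ xs) (cong₂ _xor_ (xorSum-map-∧ a _ xs) (xorSum-map-∧ b _ xs)))
                       (pairParity-isPair xs) ⟩
      ((a ∧ occurs k′ xs) xor (b ∧ occurs k xs)) xor (occurs k xs ∧ occurs k′ xs)
        ≡⟨ expand a b (occurs k xs) (occurs k′ xs) ⟩
      ((a xor occurs k xs) ∧ (b xor occurs k′ xs)) xor (a ∧ b)
        ≡⟨ cong (((a xor occurs k xs) ∧ (b xor occurs k′ xs)) xor_) not-both ⟩
      ((a xor occurs k xs) ∧ (b xor occurs k′ xs)) xor false
        ≡⟨ xor-identityʳ _ ⟩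
      (a xor occurs k xs) ∧ (b xor occurs k′ xs) ∎
      where
      open ≡-Reasoning
      a = does (x ≟ k)
      b = does (x ≟ k′)
      expand : (a b o o′ : Bool) → ((a ∧ o′) xor (b ∧ o)) xor (o ∧ o′) ≡ ((a xor o) ∧ (b xor o′)) xor (a ∧ b)
      expand = solve 4 (λ a b o o′ → ((a :* o′) :+ (b :* o)) :+ (o :* o′) := ((a :+ o) :* (b :+ o′)) :+ (a :* b)) refl
      not-both : a ∧ b ≡ false
      not-both with x ≟ k
      ... | yes refl = dec-false (k ≟ k′) k≢k′
      ... | no _     = refl

    inversions-transpose : (xs : List (Fin n)) → Unique xs → k ∈ xs → k′ ∈ xs →
                           inversions (map s xs) ≡ not (inversions xs)
    inversions-transpose xs xs! k∈xs k′∈xs = begin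
      inversions (map s xs)
        ≡⟨ pairParity-map _ s xs ⟩
      pairParity (λ x y → does (s y <? s x)) xs
        ≡⟨ pairParity-cong (AllPairs.map order-flip xs!) ⟩
      pairParity (λ x y → does (y <? x) xor isPair x y) xs
        ≡⟨ pairParity-xor _ isPair xs ⟩
      inversions xs xor pairParity isPair xs
        ≡⟨ cong (inversions xs xor_) (pairParity-isPair xs) ⟩
      inversions xs xor (occurs k xs ∧ occurs k′ xs)
        ≡⟨ cong₂ (λ o o′ → inversions xs xor (o ∧ o′)) (occurs-unique xs! k∈xs) (occurs-unique xs! k′∈xs) ⟩
      inversions xs xor true
        ≡⟨ xor-true (inversions xs) ⟩
      not (inversions xs) ∎
      where open ≡-Reasoning

    parity-transpose-adjacent : (σ : Sym n) → parity (transpose k k′ · σ) ≡ not (parity σ)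
    parity-transpose-adjacent σ =
      trans (cong inversions (map-∘ (allFin n)))
            (inversions-transpose (values σ) (values-unique σ) (∈-values σ k) (∈-values σ k′))

  parity-transpose-gap : (d : ℕ) {i j : Fin n} → toℕ j ≡ suc (d + toℕ i) → (σ : Sym n) →
                         parity (transpose i j · σ) ≡ not (parity σ)
  parity-transpose-gap zero    {i} {j} j≡1+i σ = Adjacent.parity-transpose-adjacent j≡1+i σ
  parity-transpose-gap (suc d) {i} {j} j≡2+d+i σ = begin
    parity (transpose i j · σ)
      ≡⟨ parity-cong {transpose i j · σ} {transpose j′ j · (transpose i j′ · (transpose j′ j · σ))}
                     (λ x → sym (transpose-conj-transpose i≢j′ i≢j (σ ⟨$⟩ʳ x))) ⟩
    parity (transpose j′ j · (transpose i j′ · (transpose j′ j · σ)))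
      ≡⟨ Adjacent.parity-transpose-adjacent j≡1+j′ (transpose i j′ · (transpose j′ j · σ)) ⟩
    not (parity (transpose i j′ · (transpose j′ j · σ)))
      ≡⟨ cong not (parity-transpose-gap d j′≡1+d+i (transpose j′ j · σ)) ⟩
    not (not (parity (transpose j′ j · σ)))
      ≡⟨ not-involutive _ ⟩
    parity (transpose j′ j · σ)
      ≡⟨ Adjacent.parity-transpose-adjacent j≡1+j′ σ ⟩
    not (parity σ) ∎
    where
    open ≡-Reasoning
    1+d+i<n : suc (d + toℕ i) < n
    1+d+i<n = ℕ.<-trans (subst (suc (d + toℕ i) <_) (sym j≡2+d+i) (ℕ.n<1+n _)) (toℕ<n j)
    j′ : Fin n
    j′ = fromℕ< 1+d+i<n
    j′≡1+d+i : toℕ j′ ≡ suc (d + toℕ i)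
    j′≡1+d+i = toℕ-fromℕ< 1+d+i<n
    j≡1+j′ : toℕ j ≡ suc (toℕ j′)
    j≡1+j′ = trans j≡2+d+i (cong suc (sym j′≡1+d+i))
    i≢j′ : i ≢ j′
    i≢j′ i≡j′ = ℕ.m≢1+n+m (toℕ i) (trans (cong toℕ i≡j′) j′≡1+d+i)
    i≢j : i ≢ j
    i≢j i≡j = ℕ.m≢1+n+m (toℕ i) (trans (cong toℕ i≡j) j≡2+d+i)

  parity-transpose-< : {i j : Fin n} → toℕ i < toℕ j → (σ : Sym n) → parity (transpose i j · σ) ≡ not (parity σ)
  parity-transpose-< {i} {j} i<j σ with ℕ.m≤n⇒∃[o]m+o≡n i<j
  ... | d , 1+i+d≡j = parity-transpose-gap d (trans (sym 1+i+d≡j) (cong suc (ℕ.+-comm (toℕ i) d))) σ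

  parity-transpose : {i j : Fin n} → i ≢ j → (σ : Sym n) → parity (transpose i j · σ) ≡ not (parity σ)
  parity-transpose {i} {j} i≢j σ with <-cmp i j
  ... | tri< i<j _ _ = parity-transpose-< i<j σ
  ... | tri≈ _ i≡j _ = ⊥-elim (i≢j i≡j)
  ... | tri> _ _ j<i =
    trans (parity-cong {transpose i j · σ} {transpose j i · σ} (λ x → transpose-comm i j (σ ⟨$⟩ʳ x)))
          (parity-transpose-< j<i σ)

  parity-id : parity (e {n}) ≡ false
  parity-id = begin
    inversions (map (e ⟨$⟩ʳ_) (allFin n))  ≡⟨ cong inversions (map-id (allFin n)) ⟩
    inversions (allFin n)                  ≡⟨ pairParity-cong (AllPairs.map not-inverted ascending) ⟩
    pairParity (λ _ _ → false) (allFin n)  ≡⟨ pairParity-false (allFin n) ⟩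
    false                                  ∎
    where
    open ≡-Reasoning
    ascending : AllPairs (λ x y → toℕ x < toℕ y) (allFin n)
    ascending = AllPairs.tabulate⁺-< id
    not-inverted : {x y : Fin n} → toℕ x < toℕ y → does (y <? x) ≡ false
    not-inverted {x} {y} x<y = dec-false (y <? x) (ℕ.<-asym x<y)

  prodT-++ : (ss ts : List (Transposition n)) → prodT (ss ++ ts) ≈ prodT ss · prodT ts
  prodT-++ []                   ts k = refl
  prodT-++ (((i , j) , _) ∷ ss) ts k = cong (transpose i j ⟨$⟩ʳ_) (prodT-++ ss ts k)

  -- decompose may produce trivial pairs (i , i), and eval applies the head of its list first.
  transpositions : (σ : Sym n) → Σ[ ts ∈ List (Transposition n) ] prodT ts ≈ σ
  transpositions σ = fromList (decompose σ) , λ k → trans (prodT-fromList (decompose σ) k) (eval-decompose σ k)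
    where
    fromList : TranspositionList n → List (Transposition n)
    fromList []             = []
    fromList ((i , j) ∷ xs) with i ≟ j
    ... | yes _   = fromList xs
    ... | no i≢j = fromList xs ++ [ (i , j) , i≢j ]
    prodT-fromList : (xs : TranspositionList n) → prodT (fromList xs) ≈ eval xs
    prodT-fromList []             k = refl
    prodT-fromList ((i , j) ∷ xs) k with i ≟ j
    ... | yes refl = trans (prodT-fromList xs k) (cong (eval xs ⟨$⟩ʳ_) (sym (transpose-self i k)))
    ... | no _     = trans (prodT-++ (fromList xs) _ k) (prodT-fromList xs (transpose i j ⟨$⟩ʳ k))

  parity-prodT-· : (ts : List (Transposition n)) (τ : Sym n) →
                   parity (prodT ts · τ) ≡ parity (prodT ts) xor parity τ
  parity-prodT-· []                     τ = cong (_xor parity τ) (sym parity-id)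
  parity-prodT-· (((i , j) , i≢j) ∷ ts) τ = begin
    parity (transpose i j · (prodT ts · τ))   ≡⟨ parity-transpose i≢j (prodT ts · τ) ⟩
    not (parity (prodT ts · τ))               ≡⟨ cong not (parity-prodT-· ts τ) ⟩
    not (parity (prodT ts) xor parity τ)      ≡⟨ not-distribˡ-xor (parity (prodT ts)) (parity τ) ⟩
    not (parity (prodT ts)) xor parity τ      ≡⟨ cong (_xor parity τ) (parity-transpose i≢j (prodT ts)) ⟨
    parity (transpose i j · prodT ts) xor parity τ ∎
    where open ≡-Reasoning

  parity-· : (σ τ : Sym n) → parity (σ · τ) ≡ parity σ xor parity τ
  parity-· σ τ = begin
    parity (σ · τ)                  ≡⟨ parity-cong {σ · τ} {prodT ts · τ} (λ k → sym (ts≈σ (τ ⟨$⟩ʳ k))) ⟩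
    parity (prodT ts · τ)           ≡⟨ parity-prodT-· ts τ ⟩
    parity (prodT ts) xor parity τ  ≡⟨ cong (_xor parity τ) (parity-cong {prodT ts} {σ} ts≈σ) ⟩
    parity σ xor parity τ           ∎
    where
    open ≡-Reasoning
    open Σ (transpositions σ) renaming (proj₁ to ts; proj₂ to ts≈σ)

  parity-⁻¹ : (σ : Sym n) → parity (σ ⁻¹) ≡ parity σ
  parity-⁻¹ σ = sym (xor≡false⇒≡ (parity σ) (parity (σ ⁻¹)) (begin
    parity σ xor parity (σ ⁻¹) ≡⟨ parity-· σ (σ ⁻¹) ⟨
    parity (σ · σ ⁻¹)          ≡⟨ parity-cong {σ · σ ⁻¹} {e} (λ _ → inverseʳ σ) ⟩
    parity e                   ≡⟨ parity-id ⟩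
    false                      ∎))
    where open ≡-Reasoning

  parity-even : {σ : Sym n} → IsEven σ → parity σ ≡ false
  parity-even {σ} (ts , (k , len≡k+k) , ts≈σ) =
    trans (sym (parity-cong {prodT ts} {σ} ts≈σ)) (even-length k ts len≡k+k)
    where
    even-length : (k : ℕ) (ts : List (Transposition n)) → length ts ≡ k + k → parity (prodT ts) ≡ false
    even-length zero    []      _  = parity-id
    even-length (suc k) (_ ∷ []) eq with trans (ℕ.suc-injective eq) (ℕ.+-suc k k)
    ... | ()
    even-length (suc k) (((i , j) , i≢j) ∷ ((i′ , j′) , i′≢j′) ∷ ts) eq = begin
      parity (transpose i j · (transpose i′ j′ · prodT ts))
        ≡⟨ parity-transpose i≢j (transpose i′ j′ · prodT ts) ⟩
      not (parity (transpose i′ j′ · prodT ts))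
        ≡⟨ cong not (parity-transpose i′≢j′ (prodT ts)) ⟩
      not (not (parity (prodT ts)))
        ≡⟨ not-involutive _ ⟩
      parity (prodT ts)
        ≡⟨ even-length k ts length≡k+k ⟩
      false ∎
      where
      open ≡-Reasoning
      length≡k+k : length ts ≡ k + k
      length≡k+k = ℕ.suc-injective (trans (ℕ.suc-injective eq) (ℕ.+-suc k k))

  even-or-transpose-even : {i j : Fin n} → i ≢ j → (σ : Sym n) → IsEven σ ⊎ IsEven (transpose i j · σ)
  even-or-transpose-even {i} {j} i≢j σ with transpositions σ
  ... | ts , ts≈σ with halves (length ts)
  ...   | inj₁ (k , even) = inj₁ (ts , (k , even) , ts≈σ)
  ...   | inj₂ (k , odd)  = inj₂ (((i , j) , i≢j) ∷ ts , (k , odd) , λ x → cong (transpose i j ⟨$⟩ʳ_) (ts≈σ x))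

-- Enumerating Sym n

module _ {n : ℕ} where

  insert-zero : (i : Fin (suc n)) (π : Sym n) → insert zero i π ⟨$⟩ʳ zero ≡ i
  insert-zero i π with zero {n} ≟ zero
  ... | yes _   = refl
  ... | no 0≢0 = ⊥-elim (0≢0 refl)

  insert-cong : (i : Fin (suc n)) {π π′ : Sym n} → π ≈ π′ → insert zero i π ≈ insert zero i π′
  insert-cong i {π} {π′} π≈π′ zero    = trans (insert-zero i π) (sym (insert-zero i π′))
  insert-cong i {π} {π′} π≈π′ (suc k) =
    trans (insert-punchIn zero i π k) (trans (cong (punchIn i) (π≈π′ k)) (sym (insert-punchIn zero i π′ k)))

  insert-injective : (i : Fin (suc n)) {π π′ : Sym n} → insert zero i π ≈ insert zero i π′ → π ≈ π′
  insert-injective i {π} {π′} eq k = punchIn-injective i _ _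
    (trans (sym (insert-punchIn zero i π k)) (trans (eq (suc k)) (insert-punchIn zero i π′ k)))

permutations : (n : ℕ) → List (Sym n)
blocks : {n : ℕ} → List (Fin (suc n)) → List (Sym (suc n))

permutations zero    = [ e ]
permutations (suc n) = blocks (allFin (suc n))

blocks     []       = []
blocks {n} (i ∷ is) = map (insert zero i) (permutations n) ++ blocks is

blocks-zero : {n : ℕ} (is : List (Fin (suc n))) → All (λ σ → σ ⟨$⟩ʳ zero ∈ is) (blocks is)
blocks-zero     []       = All.[]
blocks-zero {n} (i ∷ is) = All.++⁺ (All.map⁺ (All.tabulate (λ {π} _ → here (insert-zero i π))))
                                   (All.map there (blocks-zero is))

permutations-complete : (n : ℕ) (σ : Sym n) → Any (σ ≈_) (permutations n)
blocks-complete : {n : ℕ} (is : List (Fin (suc n))) (σ : Sym (suc n)) → σ ⟨$⟩ʳ zero ∈ is →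
                  Any (σ ≈_) (blocks is)

permutations-complete zero    σ = here (λ ())
permutations-complete (suc n) σ = blocks-complete (allFin (suc n)) σ (∈-allFin _)

blocks-complete {n} (i ∷ is) σ (here refl) =
  Any.++⁺ˡ (Any.map⁺ (Any.map (λ remove≈π k → trans (sym (insert-remove zero σ k)) (insert-cong i remove≈π k))
                              (permutations-complete n (remove zero σ))))
blocks-complete {n} (i ∷ is) σ (there σ0∈is) =
  Any.++⁺ʳ (map (insert zero i) (permutations n)) (blocks-complete is σ σ0∈is)

permutations-distinct : (n : ℕ) → AllPairs (λ σ τ → ¬ σ ≈ τ) (permutations n)
blocks-distinct : {n : ℕ} (is : List (Fin (suc n))) → Unique is →
                  AllPairs (λ σ τ → ¬ σ ≈ τ) (blocks is)

permutations-distinct zero    = All.[] ∷ []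
permutations-distinct (suc n) = blocks-distinct (allFin (suc n)) (Unique.allFin⁺ (suc n))

blocks-distinct     []       []           = []
blocks-distinct {n} (i ∷ is) (i∉is ∷ is!) =
  AllPairs.++⁺ (AllPairs.map⁺ (AllPairs.map (λ π≉π′ eq → π≉π′ (insert-injective i eq))
                                            (permutations-distinct n)))
               (blocks-distinct is is!)
               (All.map⁺ (All.tabulate (λ {π} _ → All.map (λ {τ} → other-block π {τ}) (blocks-zero is))))
  where
  other-block : (π : Sym n) {τ : Sym (suc n)} → τ ⟨$⟩ʳ zero ∈ is → ¬ insert zero i π ≈ τ
  other-block π τ0∈is eq =
    Unique.Unique[x∷xs]⇒x∉xs (i∉is ∷ is!) (subst (_∈ is) (trans (sym (eq zero)) (insert-zero i π)) τ0∈is)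

Sym-size : (n : ℕ) → HasSize (Sym n) _≈_ (length (permutations n))
Sym-size n = permutations n , refl , permutations-distinct n , permutations-complete n

-- The line graph of the tree

-- The tree has vertices 0, …, m + 4 and edges {0, 2}, {1, 2}, {2, 3}, …, {m + 3, m + 4}; numbering its
-- edges 0, …, m + 3 in this order, two edges a ≠ b meet iff Touch a b.
Touch : ℕ → ℕ → Set
Touch a b = (a ≤ 2 × b ≤ 2) ⊎ (b ≡ suc a × 2 ≤ a) ⊎ (a ≡ suc b × 2 ≤ b)

module _ {m : ℕ} where

  infix 4 _∼_
  _∼_ : Fin (4 + m) → Fin (4 + m) → Set
  i ∼ j = i ≢ j × Touch (toℕ i) (toℕ j)

  InTriangle : Fin (4 + m) → Set
  InTriangle x = Σ[ y ∈ Fin (4 + m) ] Σ[ z ∈ Fin (4 + m) ] x ∼ y × x ∼ z × y ∼ z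

  swap01 : Fin (4 + m) → Fin (4 + m)
  swap01 zero          = suc zero
  swap01 (suc zero)    = zero
  swap01 (suc (suc k)) = suc (suc k)

  swap01-involutive : (i : Fin (4 + m)) → swap01 (swap01 i) ≡ i
  swap01-involutive zero          = refl
  swap01-involutive (suc zero)    = refl
  swap01-involutive (suc (suc k)) = refl

  private
    0≤2 : 0 ≤ 2
    0≤2 = z≤n
    1≤2 : 1 ≤ 2
    1≤2 = s≤s z≤n
    2≤2 : 2 ≤ 2
    2≤2 = s≤s (s≤s z≤n)
    0≢1 : zero {3 + m} ≢ 1F
    0≢1 ()

  low-∼ : {i j : Fin (4 + m)} → i ≢ j → toℕ i ≤ 2 → toℕ j ≤ 2 → i ∼ j
  low-∼ i≢j i≤2 j≤2 = i≢j , inj₁ (i≤2 , j≤2)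

  in-triangle : (x : Fin (4 + m)) → toℕ x ≤ 2 → InTriangle x
  in-triangle zero             _ = 1F , 2F , low-∼ (λ ()) 0≤2 1≤2 , low-∼ (λ ()) 0≤2 2≤2 , low-∼ (λ ()) 1≤2 2≤2
  in-triangle (suc zero)       _ = 0F , 2F , low-∼ (λ ()) 1≤2 0≤2 , low-∼ (λ ()) 1≤2 2≤2 , low-∼ (λ ()) 0≤2 2≤2
  in-triangle (suc (suc zero)) _ = 0F , 1F , low-∼ (λ ()) 2≤2 0≤2 , low-∼ (λ ()) 2≤2 1≤2 , low-∼ (λ ()) 0≤2 1≤2
  in-triangle (suc (suc (suc _))) (s≤s (s≤s ()))

  high-touch : {a b : ℕ} → 3 ≤ a → Touch a b → b ≡ suc a ⊎ a ≡ suc b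
  high-touch 3≤a (inj₁ (a≤2 , _))       = ⊥-elim (ℕ.<-irrefl refl (ℕ.≤-trans 3≤a a≤2))
  high-touch 3≤a (inj₂ (inj₁ (b≡1+a , _))) = inj₁ b≡1+a
  high-touch 3≤a (inj₂ (inj₂ (a≡1+b , _))) = inj₂ a≡1+b

  gap-touch : {b : ℕ} → 2 ≤ b → ¬ Touch (suc (suc b)) b
  gap-touch 2≤b (inj₁ (s≤s (s≤s b≤0) , _)) with ℕ.≤-trans 2≤b b≤0
  ... | ()
  gap-touch {b} 2≤b (inj₂ (inj₁ (b≡3+b , _)))   = ℕ.m≢1+n+m b b≡3+b
  gap-touch {b} 2≤b (inj₂ (inj₂ (2+b≡1+b , _))) = ℕ.1+n≢n (ℕ.suc-injective 2+b≡1+b)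

  touch-sym : {a b : ℕ} → Touch a b → Touch b a
  touch-sym (inj₁ (a≤2 , b≤2))         = inj₁ (b≤2 , a≤2)
  touch-sym (inj₂ (inj₁ b≡1+a,2≤a)) = inj₂ (inj₂ b≡1+a,2≤a)
  touch-sym (inj₂ (inj₂ a≡1+b,2≤b)) = inj₂ (inj₁ a≡1+b,2≤b)

  triangle⇒low : (x : Fin (4 + m)) → InTriangle x → toℕ x ≤ 2
  triangle⇒low x (y , z , (x≢y , x∼y) , (x≢z , x∼z) , (y≢z , y∼z)) with toℕ x ≤? 2
  ... | yes x≤2 = x≤2
  ... | no  x≰2 with high-touch (ℕ.≰⇒> x≰2) x∼y | high-touch (ℕ.≰⇒> x≰2) x∼z
  ...   | inj₁ y≡1+x | inj₁ z≡1+x = ⊥-elim (y≢z (toℕ-injective (trans y≡1+x (sym z≡1+x))))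
  ...   | inj₂ x≡1+y | inj₂ x≡1+z = ⊥-elim (y≢z (toℕ-injective (ℕ.suc-injective (trans (sym x≡1+y) x≡1+z))))
  ...   | inj₁ y≡1+x | inj₂ x≡1+z = ⊥-elim $
    gap-touch (s≤s⁻¹ (subst (3 ≤_) x≡1+z (ℕ.≰⇒> x≰2)))
              (subst (λ a → Touch a (toℕ z)) (trans y≡1+x (cong suc x≡1+z)) y∼z)
  ...   | inj₂ x≡1+y | inj₁ z≡1+x = ⊥-elim $
    gap-touch (s≤s⁻¹ (subst (3 ≤_) x≡1+y (ℕ.≰⇒> x≰2)))
              (touch-sym (subst (Touch (toℕ y)) (trans z≡1+x (cong suc x≡1+y)) y∼z))

  module _ (π : Fin (4 + m) → Fin (4 + m))
           (π-injective : ∀ {i j} → π i ≡ π j → i ≡ j)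
           (π-surjective : ∀ j → ∃ λ i → π i ≡ j)
           (π-preserves : ∀ {i j} → i ∼ j → π i ∼ π j)
           (π-reflects : ∀ {i j} → π i ∼ π j → i ∼ j) where

    private
      low-preserved : (x : Fin (4 + m)) → toℕ x ≤ 2 → toℕ (π x) ≤ 2
      low-preserved x x≤2 with in-triangle x x≤2
      ... | y , z , x∼y , x∼z , y∼z =
        triangle⇒low (π x) (π y , π z , π-preserves x∼y , π-preserves x∼z , π-preserves y∼z)

      low-reflected : (x : Fin (4 + m)) → toℕ (π x) ≤ 2 → toℕ x ≤ 2
      low-reflected x πx≤2 with in-triangle (π x) πx≤2
      ... | y , z , πx∼y , πx∼z , y∼z with π-surjective y | π-surjective z
      ...   | y′ , refl | z′ , refl =
        triangle⇒low x (y′ , z′ , π-reflects πx∼y , π-reflects πx∼z , π-reflects y∼z)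

      π2≡2×π3≡3 : π 2F ≡ 2F × π 3F ≡ 3F
      π2≡2×π3≡3 with proj₂ (π-preserves {2F} {3F} ((λ ()) , inj₂ (inj₁ (refl , 2≤2))))
      ... | inj₁ (_ , π3≤2) = ⊥-elim (no-3≤2 (low-reflected 3F π3≤2))
        where
        no-3≤2 : ¬ (3 ≤ 2)
        no-3≤2 (s≤s (s≤s ()))
      ... | inj₂ (inj₂ (π2≡1+π3 , 2≤π3)) =
        ⊥-elim (ℕ.<-irrefl refl (ℕ.≤-trans (s≤s 2≤π3) (subst (_≤ 2) π2≡1+π3 (low-preserved 2F 2≤2))))
      ... | inj₂ (inj₁ (π3≡1+π2 , 2≤π2)) =
        toℕ-injective π2≡2 , toℕ-injective (trans π3≡1+π2 (cong suc π2≡2))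
        where
        π2≡2 : toℕ (π 2F) ≡ 2
        π2≡2 = ℕ.≤-antisym (low-preserved 2F 2≤2) 2≤π2

      high-fixed : (d : ℕ) (i : Fin (4 + m)) → toℕ i ≡ 2 + d → π i ≡ i
      high-fixed zero          i i≡2 with toℕ-injective {j = 2F} i≡2
      ... | refl = proj₁ π2≡2×π3≡3
      high-fixed (suc zero)    i i≡3 with toℕ-injective {j = 3F} i≡3
      ... | refl = proj₂ π2≡2×π3≡3
      high-fixed (suc (suc d)) i i≡4+d =
        neighbour (high-touch 3≤i′ (proj₂ (subst (_∼ π i) (high-fixed (suc d) i′ i′≡3+d) (π-preserves i′∼i))))
        where
        3+d<4+m : 3 + d < 4 + m
        3+d<4+m = ℕ.<-trans (ℕ.n<1+n (3 + d)) (subst (_< 4 + m) i≡4+d (toℕ<n i))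
        i′ i″ : Fin (4 + m)
        i′ = fromℕ< 3+d<4+m
        i″ = fromℕ< (ℕ.<-trans (ℕ.n<1+n (2 + d)) 3+d<4+m)
        i′≡3+d : toℕ i′ ≡ 3 + d
        i′≡3+d = toℕ-fromℕ< 3+d<4+m
        i″≡2+d : toℕ i″ ≡ 2 + d
        i″≡2+d = toℕ-fromℕ< (ℕ.<-trans (ℕ.n<1+n (2 + d)) 3+d<4+m)
        3≤i′ : 3 ≤ toℕ i′
        3≤i′ = subst (3 ≤_) (sym i′≡3+d) (s≤s (s≤s (s≤s z≤n)))
        i′∼i : i′ ∼ i
        i′∼i = (λ i′≡i → ℕ.1+n≢n (trans (sym i≡4+d) (trans (cong toℕ (sym i′≡i)) i′≡3+d)))
             , inj₂ (inj₁ (trans i≡4+d (cong suc (sym i′≡3+d)) , subst (2 ≤_) (sym i′≡3+d) (s≤s (s≤s z≤n))))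
        neighbour : toℕ (π i) ≡ suc (toℕ i′) ⊎ toℕ i′ ≡ suc (toℕ (π i)) → π i ≡ i
        neighbour (inj₁ πi≡1+i′) = toℕ-injective (trans πi≡1+i′ (trans (cong suc i′≡3+d) (sym i≡4+d)))
        neighbour (inj₂ i′≡1+πi) =
          ⊥-elim (ℕ.m≢1+n+m (2 + d) {1} (trans (sym i″≡2+d) (trans (cong toℕ i″≡i) i≡4+d)))
          where
          πi≡πi″ : π i ≡ π i″
          πi≡πi″ = toℕ-injective (trans (ℕ.suc-injective (trans (sym i′≡1+πi) i′≡3+d))
                                        (trans (sym i″≡2+d) (cong toℕ (sym (high-fixed d i″ i″≡2+d)))))
          i″≡i : i″ ≡ i
          i″≡i = sym (π-injective πi≡πi″)

      zero-or-one : (x : Fin (4 + m)) → x ≢ 2F → toℕ x ≤ 2 → x ≡ 0F ⊎ x ≡ 1F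
      zero-or-one zero                _   _ = inj₁ refl
      zero-or-one (suc zero)          _   _ = inj₂ refl
      zero-or-one (suc (suc zero))    x≢2 _ = ⊥-elim (x≢2 refl)
      zero-or-one (suc (suc (suc _))) _   (s≤s (s≤s ()))

      π-not-2 : (x : Fin (4 + m)) → x ≢ 2F → π x ≢ 2F
      π-not-2 x x≢2 πx≡2 = x≢2 (π-injective (trans πx≡2 (sym (proj₁ π2≡2×π3≡3))))

      π-01 : (x : Fin (4 + m)) → x ≢ 2F → toℕ x ≤ 2 → π x ≡ 0F ⊎ π x ≡ 1F
      π-01 x x≢2 x≤2 = zero-or-one (π x) (π-not-2 x x≢2) (low-preserved x x≤2)

    line-graph-automorphism : (∀ i → π i ≡ i) ⊎ (∀ i → π i ≡ swap01 i)
    line-graph-automorphism with π-01 0F (λ ()) 0≤2 | π-01 1F (λ ()) 1≤2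
    ... | inj₁ π0≡0 | inj₂ π1≡1 =
      inj₁ λ { zero → π0≡0 ; (suc zero) → π1≡1 ; (suc (suc k)) → high-fixed (toℕ k) _ refl }
    ... | inj₂ π0≡1 | inj₁ π1≡0 =
      inj₂ λ { zero → π0≡1 ; (suc zero) → π1≡0 ; (suc (suc k)) → high-fixed (toℕ k) _ refl }
    ... | inj₁ π0≡0 | inj₁ π1≡0 = ⊥-elim (0≢1 (π-injective (trans π0≡0 (sym π1≡0))))
    ... | inj₂ π0≡1 | inj₂ π1≡1 = ⊥-elim (0≢1 (π-injective (trans π0≡1 (sym π1≡1))))

-- The tree and its Cayley graph

module _ (m : ℕ) where

  N : ℕ
  N = 5 + m

  lo hi : Fin (4 + m) → Fin N
  lo i          = inject₁ i
  hi zero       = 2F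
  hi (suc i)    = suc (suc i)

  E : Fin (4 + m) → Sym N
  E i = transpose (lo i) (hi i)

  toℕ-lo : (i : Fin (4 + m)) → toℕ (lo i) ≡ toℕ i
  toℕ-lo = toℕ-inject₁

  lo<hi : (i : Fin (4 + m)) → toℕ (lo i) < toℕ (hi i)
  lo<hi zero    = s≤s z≤n
  lo<hi (suc i) = subst (_< suc (suc (toℕ i))) (sym (toℕ-lo (suc i))) (ℕ.n<1+n _)

  lo≢hi : (i : Fin (4 + m)) → lo i ≢ hi i
  lo≢hi i lo≡hi = ℕ.<-irrefl (cong toℕ lo≡hi) (lo<hi i)

  lo-injective : {i j : Fin (4 + m)} → lo i ≡ lo j → i ≡ j
  lo-injective {i} {j} lo≡lo = toℕ-injective (trans (sym (toℕ-lo i)) (trans (cong toℕ lo≡lo) (toℕ-lo j)))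

  Joins : Fin (4 + m) → Fin N → Fin N → Set
  Joins k u v = SamePair (lo k) (hi k) u v

  joins-lower : {k : Fin (4 + m)} {u v : Fin N} → Joins k u v → toℕ u < toℕ v → toℕ k ≡ toℕ u
  joins-lower {k} (inj₁ (lo≡u , _)) _ = trans (sym (toℕ-lo k)) (cong toℕ lo≡u)
  joins-lower {k} (inj₂ (lo≡v , hi≡u)) u<v =
    ⊥-elim (ℕ.<-asym u<v (subst₂ _<_ (cong toℕ lo≡v) (cong toℕ hi≡u) (lo<hi k)))

  joins-unique : {a b : Fin (4 + m)} {u v : Fin N} → Joins a u v → Joins b u v → u ≢ v → a ≡ b
  joins-unique {a} {b} {u} {v} a-uv b-uv u≢v with ℕ.<-cmp (toℕ u) (toℕ v)
  ... | tri< u<v _ _ = toℕ-injective (trans (joins-lower a-uv u<v) (sym (joins-lower b-uv u<v)))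
  ... | tri≈ _ u≡v _ = ⊥-elim (u≢v (toℕ-injective u≡v))
  ... | tri> _ _ v<u = toℕ-injective (trans (joins-lower (samePair-swap a-uv) v<u)
                                            (sym (joins-lower (samePair-swap b-uv) v<u)))

  E-joins : {k : Fin (4 + m)} {u v : Fin N} → E k ≈ transpose u v → Joins k u v
  E-joins {k} = transpose-injective (lo≢hi k)

  joins-edge : {a b : Fin (4 + m)} → Joins a (lo b) (hi b) → a ≡ b
  joins-edge {b = b} a-b = joins-unique a-b (inj₁ (refl , refl)) (lo≢hi b)

  E-injective : {a b : Fin (4 + m)} → E a ≈ E b → a ≡ b
  E-injective Ea≈Eb = joins-edge (E-joins Ea≈Eb)

  lower-end-unique : {a b : Fin (4 + m)} {u v w : Fin N} → Joins a u v → Joins b u w →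
                     toℕ u < toℕ v → toℕ u < toℕ w → a ≡ b
  lower-end-unique a-uv b-uw u<v u<w = toℕ-injective (trans (joins-lower a-uv u<v) (sym (joins-lower b-uw u<w)))

  no-triangle : {i j c : Fin (4 + m)} {X Y Z : Fin N} → Joins i Y X → Joins j X Z → Joins c Y Z →
                X ≢ Y → X ≢ Z → Y ≢ Z → i ≢ j → ⊥
  no-triangle {i} {j} {c} {X} {Y} {Z} i-YX j-XZ c-YZ X≢Y X≢Z Y≢Z i≢j = by-minimum (ℕ.<-cmp (toℕ X) (toℕ Y))
    where
    X-min : toℕ X < toℕ Y → toℕ X < toℕ Z → ⊥
    X-min X<Y X<Z = i≢j (lower-end-unique (samePair-swap i-YX) j-XZ X<Y X<Z)
    Y-min : toℕ Y < toℕ X → toℕ Y < toℕ Z → ⊥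
    Y-min Y<X Y<Z with lower-end-unique i-YX c-YZ Y<X Y<Z
    ... | refl = X≢Z (samePair-other i-YX c-YZ (≢-sym X≢Y))
    Z-min : toℕ Z < toℕ X → toℕ Z < toℕ Y → ⊥
    Z-min Z<X Z<Y with lower-end-unique (samePair-swap j-XZ) (samePair-swap c-YZ) Z<X Z<Y
    ... | refl = X≢Y (samePair-other (samePair-swap j-XZ) (samePair-swap c-YZ) (≢-sym X≢Z))
    by-minimum : Tri (toℕ X < toℕ Y) (toℕ X ≡ toℕ Y) (toℕ Y < toℕ X) → ⊥
    by-minimum (tri≈ _ X≡Y _) = X≢Y (toℕ-injective X≡Y)
    by-minimum (tri< X<Y _ _) with ℕ.<-cmp (toℕ X) (toℕ Z)
    ... | tri< X<Z _ _ = X-min X<Y X<Z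
    ... | tri≈ _ X≡Z _ = X≢Z (toℕ-injective X≡Z)
    ... | tri> _ _ Z<X = Z-min Z<X (ℕ.<-trans Z<X X<Y)
    by-minimum (tri> _ _ Y<X) with ℕ.<-cmp (toℕ Y) (toℕ Z)
    ... | tri< Y<Z _ _ = Y-min Y<X Y<Z
    ... | tri≈ _ Y≡Z _ = Y≢Z (toℕ-injective Y≡Z)
    ... | tri> _ _ Z<Y = Z-min (ℕ.<-trans Z<Y Y<X) Z<Y

  Meet : Fin (4 + m) → Fin (4 + m) → Set
  Meet i j = lo i ≡ lo j ⊎ lo i ≡ hi j ⊎ hi i ≡ lo j ⊎ hi i ≡ hi j

  meet? : (i j : Fin (4 + m)) → Dec (Meet i j)
  meet? i j = (lo i ≟ lo j) ⊎-dec (lo i ≟ hi j) ⊎-dec (hi i ≟ lo j) ⊎-dec (hi i ≟ hi j)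

  record Path (i j : Fin (4 + m)) : Set where
    constructor mkPath
    field
      {X Y Z} : Fin N
      i-YX : Joins i Y X
      j-XZ : Joins j X Z
      X≢Y  : X ≢ Y
      X≢Z  : X ≢ Z
      Y≢Z  : Y ≢ Z

  path : {i j : Fin (4 + m)} → i ≢ j → Meet i j → Path i j
  path {i} {j} i≢j (inj₁ lo≡lo) = ⊥-elim (i≢j (lo-injective lo≡lo))
  path {i} {j} i≢j (inj₂ (inj₁ lo≡hi)) =
    mkPath (inj₂ (refl , refl)) (inj₂ (refl , sym lo≡hi)) (lo≢hi i) (λ lo≡lo → i≢j (lo-injective lo≡lo))
      (λ hi≡lo → ℕ.<-asym (lo<hi j) (subst₂ _<_ (cong toℕ lo≡hi) (cong toℕ hi≡lo) (lo<hi i)))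
  path {i} {j} i≢j (inj₂ (inj₂ (inj₁ hi≡lo))) =
    mkPath (inj₁ (refl , refl)) (inj₁ (sym hi≡lo , refl)) (≢-sym (lo≢hi i))
      (λ hi≡hi → lo≢hi j (trans (sym hi≡lo) hi≡hi))
      (λ lo≡hi → ℕ.<-asym (lo<hi i) (subst₂ _<_ (cong toℕ (sym hi≡lo)) (cong toℕ (sym lo≡hi)) (lo<hi j)))
  path {i} {j} i≢j (inj₂ (inj₂ (inj₂ hi≡hi))) =
    mkPath (inj₁ (refl , refl)) (inj₂ (refl , sym hi≡hi)) (≢-sym (lo≢hi i))
      (λ hi≡lo → lo≢hi j (sym (trans (sym hi≡hi) hi≡lo))) (λ lo≡lo → i≢j (lo-injective lo≡lo))

  hiℕ : ℕ → ℕ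
  hiℕ zero    = 2
  hiℕ (suc k) = suc (suc k)

  toℕ-hi : (i : Fin (4 + m)) → toℕ (hi i) ≡ hiℕ (toℕ i)
  toℕ-hi zero    = refl
  toℕ-hi (suc i) = refl

  private
    touch-hiℕ : (a b : ℕ) → a ≢ b → a ≡ hiℕ b ⊎ hiℕ a ≡ b ⊎ hiℕ a ≡ hiℕ b → Touch a b
    touch-hiℕ a             zero          _   (inj₁ refl)         = inj₁ (ℕ.≤-refl , z≤n)
    touch-hiℕ a             (suc zero)    _   (inj₁ refl)         = inj₁ (ℕ.≤-refl , s≤s z≤n)
    touch-hiℕ a             (suc (suc b)) _   (inj₁ refl)         = inj₂ (inj₂ (refl , s≤s (s≤s z≤n)))
    touch-hiℕ zero          b             _   (inj₂ (inj₁ refl))  = inj₁ (z≤n , ℕ.≤-refl)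
    touch-hiℕ (suc zero)    b             _   (inj₂ (inj₁ refl))  = inj₁ (s≤s z≤n , ℕ.≤-refl)
    touch-hiℕ (suc (suc a)) b             _   (inj₂ (inj₁ refl))  = inj₂ (inj₁ (refl , s≤s (s≤s z≤n)))
    touch-hiℕ zero          zero          a≢b (inj₂ (inj₂ _))     = ⊥-elim (a≢b refl)
    touch-hiℕ zero          (suc zero)    _   (inj₂ (inj₂ _))     = inj₁ (z≤n , s≤s z≤n)
    touch-hiℕ (suc zero)    zero          _   (inj₂ (inj₂ _))     = inj₁ (s≤s z≤n , z≤n)
    touch-hiℕ (suc a)       (suc b)       a≢b (inj₂ (inj₂ eq))     =
      ⊥-elim (a≢b (cong suc (ℕ.suc-injective (ℕ.suc-injective eq))))
    touch-hiℕ zero          (suc (suc b)) _   (inj₂ (inj₂ ()))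
    touch-hiℕ (suc (suc a)) zero          _   (inj₂ (inj₂ ()))

    vertex-2 : (k : Fin (4 + m)) → toℕ k ≤ 2 → lo k ≡ 2F ⊎ hi k ≡ 2F
    vertex-2 zero                _ = inj₂ refl
    vertex-2 (suc zero)          _ = inj₂ refl
    vertex-2 (suc (suc zero))    _ = inj₁ refl
    vertex-2 (suc (suc (suc k))) (s≤s (s≤s ()))

    hi-after-lo : (i j : Fin (4 + m)) → toℕ j ≡ suc (toℕ i) → 2 ≤ toℕ i → hi i ≡ lo j
    hi-after-lo i j j≡1+i 2≤i =
      toℕ-injective (trans (toℕ-hi i) (trans (hiℕ-suc 2≤i) (trans (sym j≡1+i) (sym (toℕ-lo j)))))
      where
      hiℕ-suc : {a : ℕ} → 2 ≤ a → hiℕ a ≡ suc a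
      hiℕ-suc (s≤s _) = refl

  meet⇒∼ : {i j : Fin (4 + m)} → i ≢ j → Meet i j → i ∼ j
  meet⇒∼ {i} {j} i≢j meet =
    i≢j , touch-hiℕ (toℕ i) (toℕ j) (λ i≡j → i≢j (toℕ-injective i≡j)) (numeric meet)
    where
    numeric : Meet i j → toℕ i ≡ hiℕ (toℕ j) ⊎ hiℕ (toℕ i) ≡ toℕ j ⊎ hiℕ (toℕ i) ≡ hiℕ (toℕ j)
    numeric (inj₁ lo≡lo)                = ⊥-elim (i≢j (lo-injective lo≡lo))
    numeric (inj₂ (inj₁ lo≡hi))         = inj₁ (trans (sym (toℕ-lo i)) (trans (cong toℕ lo≡hi) (toℕ-hi j)))
    numeric (inj₂ (inj₂ (inj₁ hi≡lo)))  = inj₂ (inj₁ (trans (sym (toℕ-hi i)) (trans (cong toℕ hi≡lo) (toℕ-lo j))))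
    numeric (inj₂ (inj₂ (inj₂ hi≡hi)))  = inj₂ (inj₂ (trans (sym (toℕ-hi i)) (trans (cong toℕ hi≡hi) (toℕ-hi j))))

  ∼⇒meet : {i j : Fin (4 + m)} → i ∼ j → Meet i j
  ∼⇒meet {i} {j} (_ , inj₁ (i≤2 , j≤2)) with vertex-2 i i≤2 | vertex-2 j j≤2
  ... | inj₁ lo≡2 | inj₁ lo≡2′ = inj₁ (trans lo≡2 (sym lo≡2′))
  ... | inj₁ lo≡2 | inj₂ hi≡2  = inj₂ (inj₁ (trans lo≡2 (sym hi≡2)))
  ... | inj₂ hi≡2 | inj₁ lo≡2  = inj₂ (inj₂ (inj₁ (trans hi≡2 (sym lo≡2))))
  ... | inj₂ hi≡2 | inj₂ hi≡2′ = inj₂ (inj₂ (inj₂ (trans hi≡2 (sym hi≡2′))))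
  ∼⇒meet {i} {j} (_ , inj₂ (inj₁ (j≡1+i , 2≤i))) = inj₂ (inj₂ (inj₁ (hi-after-lo i j j≡1+i 2≤i)))
  ∼⇒meet {i} {j} (_ , inj₂ (inj₂ (i≡1+j , 2≤j))) = inj₂ (inj₁ (sym (hi-after-lo j i i≡1+j 2≤j)))

  t : Sym N
  t = transpose 0F 1F

  E-swap01 : (i : Fin (4 + m)) → E (swap01 i) ≈ transpose (t ⟨$⟩ʳ lo i) (t ⟨$⟩ʳ hi i)
  E-swap01 zero          x = refl
  E-swap01 (suc zero)    x = refl
  E-swap01 (suc (suc i)) x = refl

  t-conj-E : (i : Fin (4 + m)) → t · E i ≈ E (swap01 i) · t
  t-conj-E i x = trans (transpose-conj t (lo i) (hi i) x) (sym (E-swap01 i (t ⟨$⟩ʳ x)))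

  S : List (Sym N)
  S = map E (allFin (4 + m))

  ∈S⇒E : {σ : Sym N} → σ ∈S S → Σ[ i ∈ Fin (4 + m) ] σ ≈ E i
  ∈S⇒E σ∈S = satisfied (Any.map⁻ σ∈S)

  E⇒∈S : {σ : Sym N} (i : Fin (4 + m)) → σ ≈ E i → σ ∈S S
  E⇒∈S i σ≈Ei = Any.map⁺ (Any.map (λ { refl → σ≈Ei }) (∈-allFin i))

  isCayleySet : IsCayleySet S
  isCayleySet = e∉S , All.map⁺ (All.tabulate (λ {i} _ → E⇒∈S {E i ⁻¹} i (transpose-comm (hi i) (lo i))))
    where
    e∉S : ¬ (e ∈S S)
    e∉S e∈S with ∈S⇒E {e} e∈S
    ... | i , e≈Ei = lo≢hi i (trans (e≈Ei (lo i)) (transpose-fromˡ (lo i) (hi i)))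

  record Neighbour (u v : Sym N) : Set where
    constructor via
    field
      edge : Fin (4 + m)
      step : v ≈ E edge · u

  arc⇒neighbour : {u v : Sym N} → Arc S u v → Neighbour u v
  arc⇒neighbour {u} {v} arc with ∈S⇒E {v · u ⁻¹} arc
  ... | i , vu⁻¹≈Ei = via i λ x → trans (cong (v ⟨$⟩ʳ_) (sym (inverseˡ u))) (vu⁻¹≈Ei (u ⟨$⟩ʳ x))

  neighbour⇒arc : {u v : Sym N} → Neighbour u v → Arc S u v
  neighbour⇒arc {u} {v} (via i v≈Eiu) =
    E⇒∈S {v · u ⁻¹} i λ x → trans (v≈Eiu (u ⟨$⟩ˡ x)) (cong (E i ⟨$⟩ʳ_) (inverseʳ u))

  neighbour-cong : {u u′ v v′ : Sym N} → u ≈ u′ → v ≈ v′ → Neighbour u v → Neighbour u′ v′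
  neighbour-cong u≈u′ v≈v′ (via i v≈Eiu) =
    via i λ x → trans (sym (v≈v′ x)) (trans (v≈Eiu x) (cong (E i ⟨$⟩ʳ_) (u≈u′ x)))

  module _ (α : Aut N S) where

    f-neighbour : {u v : Sym N} → Neighbour u v → Neighbour (f α u) (f α v)
    f-neighbour {u} {v} nb = arc⇒neighbour (arc→ α u v (neighbour⇒arc nb))

    f-neighbour⁻ : {u v : Sym N} → Neighbour (f α u) (f α v) → Neighbour u v
    f-neighbour⁻ {u} {v} nb = arc⇒neighbour (arc← α u v (neighbour⇒arc nb))

    f-injective : {u v : Sym N} → f α u ≈ f α v → u ≈ v
    f-injective {u} {v} fu≈fv x = trans (sym (gf α u x)) (trans (g-cong α fu≈fv x) (gf α v x))

  mkAut : (f′ g′ : Sym N → Sym N) →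
          (∀ {u v} → u ≈ v → f′ u ≈ f′ v) → (∀ {u v} → u ≈ v → g′ u ≈ g′ v) →
          (∀ u → g′ (f′ u) ≈ u) → (∀ u → f′ (g′ u) ≈ u) →
          (∀ {u v} → Neighbour u v → Neighbour (f′ u) (f′ v)) →
          (∀ {u v} → Neighbour (f′ u) (f′ v) → Neighbour u v) → Aut N S
  mkAut f′ g′ f′-cong g′-cong g′f′ f′g′ preserves reflects = record
    { f = f′ ; g = g′ ; f-cong = f′-cong ; g-cong = g′-cong ; gf = g′f′ ; fg = f′g′
    ; arc→ = λ _ _ arc → neighbour⇒arc (preserves (arc⇒neighbour arc))
    ; arc← = λ _ _ arc → neighbour⇒arc (reflects (arc⇒neighbour arc))
    }

  infixr 9 _∘A_
  _∘A_ : Aut N S → Aut N S → Aut N S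
  α ∘A β = mkAut (λ u → f α (f β u)) (λ u → g β (g α u))
    (λ u≈v → f-cong α (f-cong β u≈v)) (λ u≈v → g-cong β (g-cong α u≈v))
    (λ u x → trans (g-cong β (gf α (f β u)) x) (gf β u x))
    (λ u x → trans (f-cong α (fg β (g α u)) x) (fg α u x))
    (λ nb → f-neighbour α (f-neighbour β nb)) (λ nb → f-neighbour⁻ β (f-neighbour⁻ α nb))

  right-mul : Sym N → Aut N S
  right-mul h = mkAut (_· h) (_· h ⁻¹)
    (λ u≈v x → u≈v (h ⟨$⟩ʳ x)) (λ u≈v x → u≈v (h ⟨$⟩ˡ x))
    (λ u x → cong (u ⟨$⟩ʳ_) (inverseʳ h)) (λ u x → cong (u ⟨$⟩ʳ_) (inverseˡ h))
    (λ (via i v≈Eiu) → via i λ x → v≈Eiu (h ⟨$⟩ʳ x))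
    (λ {u} {v} (via i vh≈Eiuh) → via i λ x →
       trans (cong (v ⟨$⟩ʳ_) (sym (inverseʳ h)))
             (trans (vh≈Eiuh (h ⟨$⟩ˡ x)) (cong (λ y → E i ⟨$⟩ʳ (u ⟨$⟩ʳ y)) (inverseʳ h))))

  left-mul-t : Aut N S
  left-mul-t = mkAut (t ·_) (t ·_)
    (λ u≈v x → cong (t ⟨$⟩ʳ_) (u≈v x)) (λ u≈v x → cong (t ⟨$⟩ʳ_) (u≈v x))
    (λ u x → transpose-involutive 0F 1F (u ⟨$⟩ʳ x)) (λ u x → transpose-involutive 0F 1F (u ⟨$⟩ʳ x))
    (λ {u} (via i v≈Eiu) → via (swap01 i) λ x → trans (cong (t ⟨$⟩ʳ_) (v≈Eiu x)) (t-conj-E i (u ⟨$⟩ʳ x)))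
    (λ {u} {v} (via j tv≈Ejtu) → via (swap01 j) λ x →
       trans (sym (transpose-involutive 0F 1F (v ⟨$⟩ʳ x)))
       (trans (cong (t ⟨$⟩ʳ_) (tv≈Ejtu x))
       (trans (t-conj-E j (t ⟨$⟩ʳ (u ⟨$⟩ʳ x)))
              (cong (E (swap01 j) ⟨$⟩ʳ_) (transpose-involutive 0F 1F (u ⟨$⟩ʳ x))))))

  t^ : Bool → Sym N
  t^ false = e
  t^ true  = t

  lrMul : Bool → Sym N → Aut N S
  lrMul false h = right-mul h
  lrMul true  h = left-mul-t ∘A right-mul h

  lrMul-apply : (x : Bool) (h u : Sym N) → f (lrMul x h) u ≈ t^ x · u · h
  lrMul-apply false h u _ = refl
  lrMul-apply true  h u _ = refl

  -- Words in the edges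

  edgeProduct : List (Fin (4 + m)) → Sym N
  edgeProduct []       = e
  edgeProduct (k ∷ ks) = E k · edgeProduct ks

  edgeProduct-++ : (ks ls : List (Fin (4 + m))) → edgeProduct (ks ++ ls) ≈ edgeProduct ks · edgeProduct ls
  edgeProduct-++ []       ls x = refl
  edgeProduct-++ (k ∷ ks) ls x = cong (E k ⟨$⟩ʳ_) (edgeProduct-++ ks ls x)

  record Word (σ : Sym N) : Set where
    constructor word
    field
      letters : List (Fin (4 + m))
      spells  : edgeProduct letters ≈ σ

  word-E : (k : Fin (4 + m)) → Word (E k)
  word-E k = word [ k ] λ _ → refl

  word-· : {σ τ : Sym N} → Word σ → Word τ → Word (σ · τ)
  word-· {σ} (word ks ks≈σ) (word ls ls≈τ) =
    word (ks ++ ls) λ x → trans (edgeProduct-++ ks ls x) (trans (ks≈σ _) (cong (σ ⟨$⟩ʳ_) (ls≈τ x)))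

  word-cong : {σ τ : Sym N} → σ ≈ τ → Word σ → Word τ
  word-cong σ≈τ (word ks ks≈σ) = word ks λ x → trans (ks≈σ x) (σ≈τ x)

  -- (0 3 + d) = E (2 + d) · (0 2 + d) · E (2 + d)
  word-0-to : (d : ℕ) (2+d<N : 2 + d < N) → Word (transpose 0F (fromℕ< 2+d<N))
  word-0-to zero    _      = word-E 0F
  word-0-to (suc d) 3+d<N =
    word-cong (λ x → trans (conj x) (transpose-cong (inj₁ (refl , hi-k)) x))
              (word-· (word-· (word-E k) to-lo) (word-E k))
    where
    2+d<N : 2 + d < N
    2+d<N = ℕ.<-trans (ℕ.n<1+n _) 3+d<N
    k : Fin (4 + m)
    k = fromℕ< (s<s⁻¹ 3+d<N)
    toℕ-k : toℕ k ≡ 2 + d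
    toℕ-k = toℕ-fromℕ< (s<s⁻¹ 3+d<N)
    lo-k : lo k ≡ fromℕ< 2+d<N
    lo-k = toℕ-injective (trans (toℕ-lo k) (trans toℕ-k (sym (toℕ-fromℕ< 2+d<N))))
    hi-k : hi k ≡ fromℕ< 3+d<N
    hi-k = toℕ-injective (trans (toℕ-hi k) (trans (cong hiℕ toℕ-k) (sym (toℕ-fromℕ< 3+d<N))))
    to-lo : Word (transpose 0F (lo k))
    to-lo = word-cong (transpose-cong (inj₁ (refl , sym lo-k))) (word-0-to d 2+d<N)
    conj : E k · transpose 0F (lo k) · E k ≈ transpose 0F (hi k)
    conj = transpose-conj-transpose {i = 0F}
      (λ 0≡lo → ℕ.0≢1+n (trans (cong toℕ 0≡lo) (trans (toℕ-lo k) toℕ-k)))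
      (λ 0≡hi → ℕ.0≢1+n (trans (cong toℕ 0≡hi) (trans (toℕ-hi k) (cong hiℕ toℕ-k))))

  word-0 : (p : Fin N) → p ≢ 0F → Word (transpose 0F p)
  word-0 zero          p≢0 = ⊥-elim (p≢0 refl)
  word-0 (suc zero)    _   = word-cong E1E0E1≈01 (word-· (word-· (word-E 1F) (word-E 0F)) (word-E 1F))
    where
    E1E0E1≈01 : E 1F · E 0F · E 1F ≈ transpose 0F 1F
    E1E0E1≈01 zero                      = refl
    E1E0E1≈01 (suc zero)                = refl
    E1E0E1≈01 (suc (suc zero))          = refl
    E1E0E1≈01 (suc (suc (suc x)))       = refl
  word-0 (suc (suc q)) _   =
    word-cong (transpose-cong (inj₁ (refl , fromℕ<-toℕ (suc (suc q)) 2+q<N))) (word-0-to (toℕ q) 2+q<N)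
    where
    2+q<N : 2 + toℕ q < N
    2+q<N = s≤s (s≤s (toℕ<n q))

  word-transpose : (a b : Fin N) → a ≢ b → Word (transpose a b)
  word-transpose a b a≢b with a ≟ 0F | b ≟ 0F
  ... | yes refl | _        = word-0 b (≢-sym a≢b)
  ... | no a≢0   | yes refl = word-cong (transpose-comm 0F a) (word-0 a a≢0)
  ... | no a≢0   | no b≢0   =
    word-cong (λ x → trans (transpose-conj-transpose b≢0 (≢-sym a≢b) x) (transpose-comm b a x))
              (word-· (word-· (word-0 a a≢0) (word-cong {τ = transpose b 0F} (transpose-comm 0F b) (word-0 b b≢0)))
                      (word-0 a a≢0))

  every-word : (σ : Sym N) → Word σ
  every-word σ = word-cong ts≈σ (products ts)
    where
    open Σ (transpositions σ) renaming (proj₁ to ts; proj₂ to ts≈σ)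
    products : (ts : List (Transposition N)) → Word (prodT ts)
    products []                     = word [] λ _ → refl
    products (((i , j) , i≢j) ∷ ts) = word-· (word-transpose i j i≢j) (products ts)

  -- The stabiliser of e

  E-involutive : (i : Fin (4 + m)) → E i · E i ≈ e
  E-involutive i = transpose-involutive (lo i) (hi i)

  two-step-paths : {w : Sym N} (a i b j : Fin (4 + m)) → w ≈ E a · E i → w ≈ E b · E j → E b · E a ≈ E j · E i
  two-step-paths a i b j w≈EaEi w≈EbEj x =
    trans (cong (E b ⟨$⟩ʳ_) (trans (cong (E a ⟨$⟩ʳ_) (sym (E-involutive i x)))
                                   (trans (sym (w≈EaEi (E i ⟨$⟩ʳ x))) (w≈EbEj (E i ⟨$⟩ʳ x)))))
          (E-involutive b (E j ⟨$⟩ʳ (E i ⟨$⟩ʳ x)))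

  Square : Fin (4 + m) → Fin (4 + m) → Set
  Square i j = Σ[ w ∈ Sym N ] Neighbour (E i) w × Neighbour (E j) w × ¬ w ≈ e

  module _ {i j : Fin (4 + m)} (i∤j : ¬ Meet i j) where

    private
      lo≢lo : lo i ≢ lo j
      lo≢lo p = i∤j (inj₁ p)
      lo≢hi′ : lo i ≢ hi j
      lo≢hi′ p = i∤j (inj₂ (inj₁ p))
      hi≢lo : hi i ≢ lo j
      hi≢lo p = i∤j (inj₂ (inj₂ (inj₁ p)))
      hi≢hi : hi i ≢ hi j
      hi≢hi p = i∤j (inj₂ (inj₂ (inj₂ p)))

    disjoint-commute : E j · E i ≈ E i · E j
    disjoint-commute x = trans (transpose-conj (E j) (lo i) (hi i) x)
      (transpose-cong (inj₁ (transpose-fix lo≢lo lo≢hi′ , transpose-fix hi≢lo hi≢hi)) (E j ⟨$⟩ʳ x))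

    disjoint-square : Square i j
    disjoint-square = E j · E i , via j (λ _ → refl) , via i disjoint-commute , moves-lo
      where
      moves-lo : ¬ E j · E i ≈ e
      moves-lo EjEi≈e = lo≢hi i (sym (begin
        hi i                          ≡⟨ transpose-fix hi≢lo hi≢hi ⟨
        E j ⟨$⟩ʳ hi i                 ≡⟨ cong (E j ⟨$⟩ʳ_) (transpose-fromˡ (lo i) (hi i)) ⟨
        E j ⟨$⟩ʳ (E i ⟨$⟩ʳ lo i)      ≡⟨ EjEi≈e (lo i) ⟩
        lo i                          ∎))
        where open ≡-Reasoning

    disjoint-square-unique : {w : Sym N} → Neighbour (E i) w → Neighbour (E j) w → w ≈ e ⊎ w ≈ E j · E i
    disjoint-square-unique {w} (via a w≈EaEi) (via b w≈EbEj)
      with factor-disjoint (lo≢hi j) (≢-sym lo≢lo) (≢-sym hi≢lo) (≢-sym lo≢hi′) (≢-sym hi≢hi) (lo≢hi i)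
                           (two-step-paths {w} a i b j w≈EaEi w≈EbEj)
    ... | inj₁ (_ , a-i) with joins-edge a-i
    ...   | refl = inj₁ λ x → trans (w≈EaEi x) (E-involutive a x)
    disjoint-square-unique {w} (via a w≈EaEi) (via b w≈EbEj)
        | inj₂ (_ , a-j) with joins-edge a-j
    ...   | refl = inj₂ w≈EaEi

  meet-no-square : {i j : Fin (4 + m)} → i ≢ j → Meet i j → ¬ Square i j
  meet-no-square {i} {j} i≢j meet (w , via a w≈EaEi , via b w≈EbEj , w≉e)
    with path i≢j meet
  ... | mkPath {X} {Y} {Z} i-YX j-XZ X≢Y X≢Z Y≢Z
    with factor-three-cycle (≢-sym X≢Y) X≢Z Y≢Z (λ x →
           trans (two-step-paths {w} a i b j w≈EaEi w≈EbEj x)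
                 (trans (cong (E j ⟨$⟩ʳ_) (transpose-cong i-YX x)) (transpose-cong j-XZ (transpose Y X ⟨$⟩ʳ x))))
  ... | inj₁ (a-YX , _) with joins-unique a-YX i-YX (≢-sym X≢Y)
  ...   | refl = w≉e λ x → trans (w≈EaEi x) (E-involutive a x)
  meet-no-square {i} {j} i≢j meet (w , via a w≈EaEi , via b w≈EbEj , w≉e)
      | mkPath i-YX j-XZ X≢Y X≢Z Y≢Z | inj₂ (inj₁ (_ , b-ZY)) =
    no-triangle i-YX j-XZ (samePair-swap b-ZY) X≢Y X≢Z Y≢Z i≢j
  meet-no-square {i} {j} i≢j meet (w , via a w≈EaEi , via b w≈EbEj , w≉e)
      | mkPath i-YX j-XZ X≢Y X≢Z Y≢Z | inj₂ (inj₂ (a-ZY , _)) =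
    no-triangle i-YX j-XZ (samePair-swap a-ZY) X≢Y X≢Z Y≢Z i≢j

  module OnEdges (α : Aut N S) (α-e : f α e ≈ e) where

    private
      moved : (i : Fin (4 + m)) → Neighbour (f α e) (f α (E i))
      moved i = f-neighbour α (via i (λ _ → refl))

    π : Fin (4 + m) → Fin (4 + m)
    π i = Neighbour.edge (moved i)

    f-E : (i : Fin (4 + m)) → f α (E i) ≈ E (π i)
    f-E i x = trans (Neighbour.step (moved i) x) (cong (E (π i) ⟨$⟩ʳ_) (α-e x))

    π-injective : {i j : Fin (4 + m)} → π i ≡ π j → i ≡ j
    π-injective {i} {j} πi≡πj = E-injective (f-injective α λ x →
      trans (f-E i x) (trans (cong (λ k → E k ⟨$⟩ʳ x) πi≡πj) (sym (f-E j x))))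

    π-surjective : (j : Fin (4 + m)) → ∃ λ i → π i ≡ j
    π-surjective j = i , E-injective λ x → trans (sym (f-E i x)) (trans (f-cong α Ei≈v x) (fg α (E j) x))
      where
      v = g α (E j)
      e→v : Neighbour e v
      e→v = f-neighbour⁻ α (via j λ x → trans (fg α (E j) x) (cong (E j ⟨$⟩ʳ_) (sym (α-e x))))
      i = Neighbour.edge e→v
      Ei≈v : E i ≈ v
      Ei≈v x = sym (Neighbour.step e→v x)

    square-preserved : {i j : Fin (4 + m)} → Square i j → Square (π i) (π j)
    square-preserved {i} {j} (w , Ei→w , Ej→w , w≉e) =
      f α w , neighbour-cong (f-E i) (λ _ → refl) (f-neighbour α Ei→w)
            , neighbour-cong (f-E j) (λ _ → refl) (f-neighbour α Ej→w)
            , λ fw≈e → w≉e (f-injective α λ x → trans (fw≈e x) (sym (α-e x)))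

    square-reflected : {i j : Fin (4 + m)} → Square (π i) (π j) → Square i j
    square-reflected {i} {j} (w , Eπi→w , Eπj→w , w≉e) =
      g α w , f-neighbour⁻ α (neighbour-cong (λ x → sym (f-E i x)) (λ x → sym (fg α w x)) Eπi→w)
            , f-neighbour⁻ α (neighbour-cong (λ x → sym (f-E j x)) (λ x → sym (fg α w x)) Eπj→w)
            , λ gw≈e → w≉e λ x → trans (sym (fg α w x)) (trans (f-cong α gw≈e x) (α-e x))

    π-preserves : {i j : Fin (4 + m)} → i ∼ j → π i ∼ π j
    π-preserves {i} {j} i∼j@(i≢j , _) = decide (meet? (π i) (π j))
      where
      decide : Dec (Meet (π i) (π j)) → π i ∼ π j
      decide (yes meet) = meet⇒∼ (λ πi≡πj → i≢j (π-injective πi≡πj)) meet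
      decide (no ¬meet) = ⊥-elim (meet-no-square i≢j (∼⇒meet i∼j) (square-reflected (disjoint-square ¬meet)))

    π-reflects : {i j : Fin (4 + m)} → π i ∼ π j → i ∼ j
    π-reflects {i} {j} πi∼πj@(πi≢πj , _) = decide (meet? i j)
      where
      decide : Dec (Meet i j) → i ∼ j
      decide (yes meet) = meet⇒∼ (λ i≡j → πi≢πj (cong π i≡j)) meet
      decide (no ¬meet) = ⊥-elim (meet-no-square πi≢πj (∼⇒meet πi∼πj) (square-preserved (disjoint-square ¬meet)))

  stabiliser-on-edges : (α : Aut N S) → f α e ≈ e →
                        (∀ i → f α (E i) ≈ E i) ⊎ (∀ i → f α (E i) ≈ E (swap01 i))
  stabiliser-on-edges α α-e =
    Sum.map (λ π≡id i x → trans (f-E i x) (cong (λ k → E k ⟨$⟩ʳ x) (π≡id i)))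
            (λ π≡swap i x → trans (f-E i x) (cong (λ k → E k ⟨$⟩ʳ x) (π≡swap i)))
            (line-graph-automorphism π π-injective π-surjective π-preserves π-reflects)
    where open OnEdges α α-e

  braid : E 2F · E 0F · E 2F ≈ transpose 0F 3F
  braid zero                      = refl
  braid (suc zero)                = refl
  braid (suc (suc zero))          = refl
  braid (suc (suc (suc zero)))    = refl
  braid (suc (suc (suc (suc x)))) = refl

  braid′ : E 0F · E 2F · E 0F ≈ transpose 0F 3F
  braid′ zero                      = refl
  braid′ (suc zero)                = refl
  braid′ (suc (suc zero))          = refl
  braid′ (suc (suc (suc zero)))    = refl
  braid′ (suc (suc (suc (suc x)))) = refl

  conjugate : Aut N S → Sym N → Aut N S
  conjugate β h = right-mul (h ⁻¹) ∘A β ∘A right-mul h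

  module _ (β : Aut N S) (h : Sym N) where

    conjugate-maps : (u v : Sym N) → f (conjugate β h) u ≈ v → f β (u · h) ≈ v · h
    conjugate-maps u v = ·⁻¹≈⇒≈· {σ = f β (u · h)} {v} {h}

    conjugate-fixes : (u : Sym N) → f β (u · h) ≈ u · h → f (conjugate β h) u ≈ u
    conjugate-fixes u = ≈·⇒·⁻¹≈ {σ = f β (u · h)} {u} {h}

  no-edge-03 : {c : Fin (4 + m)} → ¬ Joins c 0F 3F
  no-edge-03 c-03 with toℕ-injective {j = 0F} (joins-lower c-03 (s≤s z≤n))
  no-edge-03 (inj₁ (_ , ())) | refl
  no-edge-03 (inj₂ (() , _)) | refl

  module FixingEdges (β : Aut N S) (β-e : f β e ≈ e) (β-E : ∀ i → f β (E i) ≈ E i) where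

    private
      ψ : Fin (4 + m) → Aut N S
      ψ k = conjugate β (E k)

      ψ-e : (k : Fin (4 + m)) → f (ψ k) e ≈ e
      ψ-e k = conjugate-fixes β (E k) e λ x → trans (f-cong β {e · E k} {E k} (λ _ → refl) x) (β-E k x)

      ψ-E : (k : Fin (4 + m)) → f (ψ k) (E k) ≈ E k
      ψ-E k = conjugate-fixes β (E k) (E k) λ x →
        trans (f-cong β {E k · E k} {e} (E-involutive k) x) (trans (β-e x) (sym (E-involutive k x)))

      ψ-disjoint : {j k : Fin (4 + m)} → j ≢ k → ¬ Meet j k → f (ψ k) (E j) ≈ E j
      ψ-disjoint {j} {k} j≢k j∤k = conjugate-fixes β (E k) (E j) (common (disjoint-square-unique j∤k Ej→w Ek→w))
        where
        w = f β (E j · E k)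
        Ej→w : Neighbour (E j) w
        Ej→w = neighbour-cong (β-E j) (λ _ → refl) (f-neighbour β (via k λ x → sym (disjoint-commute j∤k x)))
        Ek→w : Neighbour (E k) w
        Ek→w = neighbour-cong (β-E k) (λ _ → refl) (f-neighbour β (via j (λ _ → refl)))
        common : w ≈ e ⊎ w ≈ E k · E j → w ≈ E j · E k
        common (inj₁ w≈e) = ⊥-elim (j≢k (E-injective λ x →
          trans (cong (E j ⟨$⟩ʳ_) (sym (E-involutive k x)))
                (f-injective β (λ y → trans (w≈e y) (sym (β-e y))) (E k ⟨$⟩ʳ x))))
        common (inj₂ w≈EkEj) x = trans (w≈EkEj x) (disjoint-commute j∤k x)

      -- E 2 · E 0 · E 2 ≈ E 0 · E 2 · E 0 is a common neighbour of E 0 · E 2 and E 2 · E 0; if β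
      -- moved the first to E 1 · E 2 and fixed the second, (0 3) · (1 2) would be a product of two edges.
      hexagon : (∀ j → f (ψ 2F) (E j) ≈ E (swap01 j)) → (∀ j → f β (E j · E 0F) ≈ E j · E 0F) → ⊥
      hexagon swaps fixed-at-0 = no-factorisation E1E2→βw E2E0→βw
        where
        w : Sym N
        w = E 2F · E 0F · E 2F
        E1E2→βw : Neighbour (E 1F · E 2F) (f β w)
        E1E2→βw = neighbour-cong (conjugate-maps β (E 2F) (E 0F) (E 1F) (swaps 0F)) (λ _ → refl)
                                 (f-neighbour β (via 2F λ _ → refl))
        E2E0→βw : Neighbour (E 2F · E 0F) (f β w)
        E2E0→βw = neighbour-cong (fixed-at-0 2F) (λ _ → refl)
                                 (f-neighbour β (via 0F λ x → trans (braid x) (sym (braid′ x))))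
        no-factorisation : Neighbour (E 1F · E 2F) (f β w) → Neighbour (E 2F · E 0F) (f β w) → ⊥
        no-factorisation (via a βw≈EaE1E2) (via b βw≈EbE2E0) =
          Sum.[ no-edge-03 ∘ proj₁ , no-edge-03 ∘ proj₂ ]′
            (factor-disjoint (λ ()) (λ ()) (λ ()) (λ ()) (λ ()) (λ ()) EbEa≈03·12)
          where
          EbEa≈03·12 : E b · E a ≈ transpose 0F 3F · E 1F
          EbEa≈03·12 x = begin
            E b ⟨$⟩ʳ (E a ⟨$⟩ʳ x)                          ≡⟨ cong (λ z → E b ⟨$⟩ʳ (E a ⟨$⟩ʳ z)) E1E2y≡x ⟨
            E b ⟨$⟩ʳ (E a ⟨$⟩ʳ (E 1F ⟨$⟩ʳ (E 2F ⟨$⟩ʳ y)))    ≡⟨ cong (E b ⟨$⟩ʳ_) (βw≈EaE1E2 y) ⟨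
            E b ⟨$⟩ʳ (f β w ⟨$⟩ʳ y)                        ≡⟨ cong (E b ⟨$⟩ʳ_) (βw≈EbE2E0 y) ⟩
            E b ⟨$⟩ʳ (E b ⟨$⟩ʳ (E 2F ⟨$⟩ʳ (E 0F ⟨$⟩ʳ y)))    ≡⟨ E-involutive b _ ⟩
            E 2F ⟨$⟩ʳ (E 0F ⟨$⟩ʳ (E 2F ⟨$⟩ʳ (E 1F ⟨$⟩ʳ x))) ≡⟨ braid (E 1F ⟨$⟩ʳ x) ⟩
            transpose 0F 3F ⟨$⟩ʳ (E 1F ⟨$⟩ʳ x)             ∎
            where
            open ≡-Reasoning
            y = E 2F ⟨$⟩ʳ (E 1F ⟨$⟩ʳ x)
            E1E2y≡x : E 1F ⟨$⟩ʳ (E 2F ⟨$⟩ʳ y) ≡ x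
            E1E2y≡x = trans (cong (E 1F ⟨$⟩ʳ_) (E-involutive 2F (E 1F ⟨$⟩ʳ x))) (E-involutive 1F x)

      no-swap : (k : Fin (4 + m)) → swap01 k ≡ k → (∀ j → f (ψ k) (E j) ≈ E (swap01 j)) →
                (k ≡ 2F → ∀ j → f β (E j · E 0F) ≈ E j · E 0F) → ⊥
      no-swap zero                ()
      no-swap (suc zero)          ()
      no-swap (suc (suc zero))    _ swaps at-2 = hexagon swaps (at-2 refl)
      no-swap (suc (suc (suc k))) _ swaps _    =
        1≢0 (E-injective λ x → trans (sym (swaps 0F x)) (ψ-disjoint (λ ()) 0∤k x))
        where
        1≢0 : 1F ≢ zero {3 + m}
        1≢0 ()
        0∤k : ¬ Meet 0F (suc (suc (suc k)))
        0∤k meet with proj₂ (meet⇒∼ (λ ()) meet)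
        ... | inj₁ (_ , s≤s (s≤s ()))
        ... | inj₂ (inj₁ (_ , ()))
        ... | inj₂ (inj₂ (() , _))

      fixed-or-swapped : (k : Fin (4 + m)) → (k ≡ 2F → ∀ j → f β (E j · E 0F) ≈ E j · E 0F) →
                         ∀ j → f β (E j · E k) ≈ E j · E k
      fixed-or-swapped k at-2 = Sum.[ if-fixed , if-swapped ]′ (stabiliser-on-edges (ψ k) (ψ-e k))
        where
        if-fixed : (∀ j → f (ψ k) (E j) ≈ E j) → ∀ j → f β (E j · E k) ≈ E j · E k
        if-fixed fixes j = conjugate-maps β (E k) (E j) (E j) (fixes j)
        if-swapped : (∀ j → f (ψ k) (E j) ≈ E (swap01 j)) → ∀ j → f β (E j · E k) ≈ E j · E k
        if-swapped swaps = ⊥-elim (no-swap k (E-injective λ x → trans (sym (swaps k x)) (ψ-E k x)) swaps at-2)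

    fixes-E·E : ∀ k j → f β (E j · E k) ≈ E j · E k
    fixes-E·E k = fixed-or-swapped k (λ _ → fixed-or-swapped 0F (λ ()))

  fixing-edges-fixes-all : (β : Aut N S) → f β e ≈ e → (∀ i → f β (E i) ≈ E i) → ∀ u → f β u ≈ u
  fixing-edges-fixes-all β β-e β-E u x =
    trans (f-cong β (λ y → sym (spells y)) x) (trans (proj₁ (fixed-word letters) x) (spells x))
    where
    open Word (every-word u)
    Fixed : Sym N → Set
    Fixed v = f β v ≈ v × (∀ j → f β (E j · v) ≈ E j · v)

    fixed-e : Fixed e
    fixed-e = β-e , λ j x → trans (f-cong β {E j · e} {E j} (λ _ → refl) x) (β-E j x)

    fixed-step : (k : Fin (4 + m)) {v : Sym N} → Fixed v → Fixed (E k · v)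
    fixed-step k {v} (β-v , β-Ev) = β-Ev k , λ j x →
      trans (f-cong β {E j · (E k · v)} {E j · E k · v} (λ _ → refl) x)
            (conjugate-maps β v (E j · E k) (E j · E k) (FixingEdges.fixes-E·E (conjugate β v) ψ-e ψ-E k j) x)
      where
      ψ-e : f (conjugate β v) e ≈ e
      ψ-e = conjugate-fixes β v e λ x → trans (f-cong β {e · v} {v} (λ _ → refl) x) (β-v x)
      ψ-E : ∀ i → f (conjugate β v) (E i) ≈ E i
      ψ-E i = conjugate-fixes β v (E i) (β-Ev i)

    fixed-word : (ks : List (Fin (4 + m))) → Fixed (edgeProduct ks)
    fixed-word []       = fixed-e
    fixed-word (k ∷ ks) = fixed-step k (fixed-word ks)

  automorphism-shape : (α : Aut N S) → Σ[ x ∈ Bool ] Σ[ h ∈ Sym N ] (∀ u → f α u ≈ t^ x · u · h)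
  automorphism-shape α = shape (stabiliser-on-edges α′ α′-e)
    where
    h = f α e
    α′ : Aut N S
    α′ = right-mul (h ⁻¹) ∘A α
    α′-e : f α′ e ≈ e
    α′-e x = inverseʳ h
    from-α′ : (u v : Sym N) → f α′ u ≈ v → f α u ≈ v · h
    from-α′ u v = ·⁻¹≈⇒≈· {σ = f α u} {v} {h}
    tt≈e : t · t ≈ e
    tt≈e = transpose-involutive 0F 1F
    shape : (∀ i → f α′ (E i) ≈ E i) ⊎ (∀ i → f α′ (E i) ≈ E (swap01 i)) →
            Σ[ x ∈ Bool ] Σ[ h ∈ Sym N ] (∀ u → f α u ≈ t^ x · u · h)
    shape (inj₁ fixes) = false , h , λ u → from-α′ u u (fixing-edges-fixes-all α′ α′-e fixes u)
    shape (inj₂ swaps) =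
      true , t · h , λ u → from-α′ u (t · u · t) (t-conjugate (fixing-edges-fixes-all α″ α″-e α″-E u))
      where
      α″ : Aut N S
      α″ = left-mul-t ∘A right-mul t ∘A α′
      α″-e : f α″ e ≈ e
      α″-e x = trans (cong (t ⟨$⟩ʳ_) (α′-e (t ⟨$⟩ʳ x))) (tt≈e x)
      α″-E : ∀ i → f α″ (E i) ≈ E i
      α″-E i x = begin
        t ⟨$⟩ʳ (f α′ (E i) ⟨$⟩ʳ (t ⟨$⟩ʳ x))          ≡⟨ cong (t ⟨$⟩ʳ_) (swaps i (t ⟨$⟩ʳ x)) ⟩
        t ⟨$⟩ʳ (E (swap01 i) ⟨$⟩ʳ (t ⟨$⟩ʳ x))        ≡⟨ t-conj-E (swap01 i) (t ⟨$⟩ʳ x) ⟩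
        E (swap01 (swap01 i)) ⟨$⟩ʳ (t ⟨$⟩ʳ (t ⟨$⟩ʳ x))
          ≡⟨ cong₂ (λ k y → E k ⟨$⟩ʳ y) (swap01-involutive i) (tt≈e x) ⟩
        E i ⟨$⟩ʳ x                                   ∎
        where open ≡-Reasoning
      t-conjugate : {u : Sym N} → f α″ u ≈ u → f α′ u ≈ t · u · t
      t-conjugate {u} eq x = trans (sym (tt≈e (f α′ u ⟨$⟩ʳ x)))
        (cong (t ⟨$⟩ʳ_) (trans (cong (λ y → t ⟨$⟩ʳ (f α′ u ⟨$⟩ʳ y)) (sym (tt≈e x))) (eq (t ⟨$⟩ʳ x))))

  -- The Cayley index and the regular subgroup

  t^-xor : (x y : Bool) → t^ (x xor y) ≈ t^ x · t^ y
  t^-xor false y     _ = refl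
  t^-xor true  false _ = refl
  t^-xor true  true  z = sym (transpose-involutive 0F 1F z)

  lrMul-cong : (x : Bool) {h k : Sym N} → h ≈ k → lrMul x h ≈A lrMul x k
  lrMul-cong x {h} {k} h≈k u z = trans (lrMul-apply x h u z)
    (trans (cong (λ y → t^ x ⟨$⟩ʳ (u ⟨$⟩ʳ y)) (h≈k z)) (sym (lrMul-apply x k u z)))

  t-not-translation : {h k : Sym N} → lrMul true h ≈A lrMul false k → ⊥
  t-not-translation {h} {k} eq = differ (t-E1-commute 0F)
    where
    differ : t ⟨$⟩ʳ (E 1F ⟨$⟩ʳ 0F) ≢ E 1F ⟨$⟩ʳ (t ⟨$⟩ʳ 0F)
    differ ()
    t-E1-commute : ∀ z → t ⟨$⟩ʳ (E 1F ⟨$⟩ʳ z) ≡ E 1F ⟨$⟩ʳ (t ⟨$⟩ʳ z)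
    t-E1-commute z = begin
      t ⟨$⟩ʳ (E 1F ⟨$⟩ʳ z)                  ≡⟨ cong (λ y → t ⟨$⟩ʳ (E 1F ⟨$⟩ʳ y)) (inverseʳ h) ⟨
      t ⟨$⟩ʳ (E 1F ⟨$⟩ʳ (h ⟨$⟩ʳ (h ⟨$⟩ˡ z))) ≡⟨ eq (E 1F) (h ⟨$⟩ˡ z) ⟩
      E 1F ⟨$⟩ʳ (k ⟨$⟩ʳ (h ⟨$⟩ˡ z))         ≡⟨ cong (E 1F ⟨$⟩ʳ_) (eq e (h ⟨$⟩ˡ z)) ⟨
      E 1F ⟨$⟩ʳ (t ⟨$⟩ʳ (h ⟨$⟩ʳ (h ⟨$⟩ˡ z))) ≡⟨ cong (λ y → E 1F ⟨$⟩ʳ (t ⟨$⟩ʳ y)) (inverseʳ h) ⟩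
      E 1F ⟨$⟩ʳ (t ⟨$⟩ʳ z)                  ∎
      where open ≡-Reasoning

  lrMul-injective : (x y : Bool) {h k : Sym N} → lrMul x h ≈A lrMul y k → x ≡ y × h ≈ k
  lrMul-injective false false eq = refl , eq e
  lrMul-injective true  true  eq = refl , λ z → ⟨$⟩ʳ-injective t (eq e z)
  lrMul-injective true  false {h} {k} eq = ⊥-elim (t-not-translation {h} {k} eq)
  lrMul-injective false true  {h} {k} eq = ⊥-elim (t-not-translation {k} {h} λ u z → sym (eq u z))

  automorphisms : List (Aut N S)
  automorphisms = map (lrMul false) (permutations N) ++ map (lrMul true) (permutations N)

  automorphisms-length : length automorphisms ≡ 2 * length (permutations N)
  automorphisms-length = trans (length-++ (map (lrMul false) L))
    (trans (cong₂ _+_ (length-map (lrMul false) L) (length-map (lrMul true) L))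
           (cong (length L +_) (sym (ℕ.+-identityʳ (length L)))))
    where L = permutations N

  automorphisms-distinct : AllPairs (λ α β → ¬ α ≈A β) automorphisms
  automorphisms-distinct = AllPairs.++⁺ (distinct-block false) (distinct-block true)
    (All.map⁺ (All.tabulate λ {h} _ → All.map⁺ (All.tabulate λ {k} _ eq →
      false≢true (proj₁ (lrMul-injective false true {h} {k} eq)))))
    where
    false≢true : false ≢ true
    false≢true ()
    distinct-block : (x : Bool) → AllPairs (λ α β → ¬ α ≈A β) (map (lrMul x) (permutations N))
    distinct-block x = AllPairs.map⁺ (AllPairs.map (λ {h} {k} h≉k eq → h≉k (proj₂ (lrMul-injective x x {h} {k} eq)))
                                                    (permutations-distinct N))

  automorphisms-complete : (α : Aut N S) → Any (α ≈A_) automorphisms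
  automorphisms-complete α = place (automorphism-shape α)
    where
    in-block : (x : Bool) (h : Sym N) → (∀ u → f α u ≈ t^ x · u · h) → Any (α ≈A_) (map (lrMul x) (permutations N))
    in-block x h α≈ =
      Any.map⁺ (Any.map (λ {k} h≈k u z →
                           trans (α≈ u z) (trans (sym (lrMul-apply x h u z)) (lrMul-cong x {h} {k} h≈k u z)))
                         (permutations-complete N h))
    place : Σ[ x ∈ Bool ] Σ[ h ∈ Sym N ] (∀ u → f α u ≈ t^ x · u · h) → Any (α ≈A_) automorphisms
    place (false , h , α≈) = Any.++⁺ˡ (in-block false h α≈)
    place (true  , h , α≈) = Any.++⁺ʳ (map (lrMul false) (permutations N)) (in-block true h α≈)

  cayleyIndex : CayleyIndex S 2
  cayleyIndex = length (permutations N) , Sym-size N ,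
                automorphisms , automorphisms-length , automorphisms-distinct , automorphisms-complete

  parity-·-even⁻¹ : (u : Sym N) {a : Sym N} → IsEven a → parity (u · a ⁻¹) ≡ parity u
  parity-·-even⁻¹ u {a} a-even = begin
    parity (u · a ⁻¹)          ≡⟨ parity-· u (a ⁻¹) ⟩
    parity u xor parity (a ⁻¹) ≡⟨ cong (parity u xor_) (trans (parity-⁻¹ a) (parity-even {σ = a} a-even)) ⟩
    parity u xor false         ≡⟨ xor-identityʳ (parity u) ⟩
    parity u                   ∎
    where open ≡-Reasoning

  t-odd : (u : Sym N) {a b : Sym N} → IsEven a → IsEven b → ¬ t · u · a ⁻¹ ≈ u · b ⁻¹
  t-odd u {a} {b} a-even b-even eq = not-¬ refl (sym (begin
    not (parity u)               ≡⟨ cong not (parity-·-even⁻¹ u {a} a-even) ⟨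
    not (parity (u · a ⁻¹))      ≡⟨ parity-transpose 0≢1 (u · a ⁻¹) ⟨
    parity (t · (u · a ⁻¹))      ≡⟨ parity-cong {σ = t · (u · a ⁻¹)} {τ = u · b ⁻¹} eq ⟩
    parity (u · b ⁻¹)            ≡⟨ parity-·-even⁻¹ u {b} b-even ⟩
    parity u                     ∎))
    where
    open ≡-Reasoning
    0≢1 : 0F ≢ 1F
    0≢1 ()

  regular : RegularAltZ2 N S
  regular = record
    { φ           = λ a _ x → lrMul x (a ⁻¹)
    ; φ-cong      = λ a a′ _ _ x a≈a′ → lrMul-cong x (⁻¹-cong {σ = a} {a′} a≈a′)
    ; φ-hom       = λ a b _ _ x y _ u z →
        trans (lrMul-apply (x xor y) ((a · b) ⁻¹) u z)
       (trans (t^-xor x y _)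
        (sym (trans (lrMul-apply x (a ⁻¹) _ z) (cong (t^ x ⟨$⟩ʳ_) (lrMul-apply y (b ⁻¹) u (a ⁻¹ ⟨$⟩ʳ z))))))
    ; φ-inj       = λ a b _ _ x y eq →
        ⁻¹-cong {σ = a ⁻¹} {b ⁻¹} (proj₂ (lrMul-injective x y eq)) , proj₁ (lrMul-injective x y eq)
    ; transitive  = transitive
    ; semiregular = semiregular
    }
    where
    transitive : ∀ u v → Σ[ a ∈ Sym N ] Σ[ _ ∈ IsEven a ] Σ[ x ∈ Bool ] f (lrMul x (a ⁻¹)) u ≈ v
    transitive u v = Sum.[ untwisted , twisted ]′ (even-or-transpose-even v⁻¹0≢v⁻¹1 (v ⁻¹ · u))
      where
      v⁻¹0≢v⁻¹1 : v ⁻¹ ⟨$⟩ʳ 0F ≢ v ⁻¹ ⟨$⟩ʳ 1F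
      v⁻¹0≢v⁻¹1 eq with ⟨$⟩ʳ-injective (v ⁻¹) eq
      ... | ()
      untwisted : IsEven (v ⁻¹ · u) → Σ[ a ∈ Sym N ] Σ[ _ ∈ IsEven a ] Σ[ x ∈ Bool ] f (lrMul x (a ⁻¹)) u ≈ v
      untwisted even = v ⁻¹ · u , even , false , quotient-inverse {a = v ⁻¹ · u} {v} {u} (λ _ → refl)
      τv⁻¹u : Sym N
      τv⁻¹u = transpose (v ⁻¹ ⟨$⟩ʳ 0F) (v ⁻¹ ⟨$⟩ʳ 1F) · (v ⁻¹ · u)
      twisted : IsEven τv⁻¹u → Σ[ a ∈ Sym N ] Σ[ _ ∈ IsEven a ] Σ[ x ∈ Bool ] f (lrMul x (a ⁻¹)) u ≈ v
      twisted even = τv⁻¹u , even , true ,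
        quotient-inverse {a = τv⁻¹u} {v} {t · u} (λ z → sym (transpose-conj (v ⁻¹) 0F 1F (u ⟨$⟩ʳ z)))
    semiregular : ∀ u a b (_ : IsEven a) (_ : IsEven b) x y →
                  f (lrMul x (a ⁻¹)) u ≈ f (lrMul y (b ⁻¹)) u → a ≈ b × x ≡ y
    semiregular u a b _ _ false false eq = ⁻¹-cong {σ = a ⁻¹} {b ⁻¹} (·-cancelˡ u {a ⁻¹} {b ⁻¹} eq) , refl
    semiregular u a b _ _ true  true  eq = ⁻¹-cong {σ = a ⁻¹} {b ⁻¹} (·-cancelˡ (t · u) {a ⁻¹} {b ⁻¹} eq) , refl
    semiregular u a b a-even b-even true  false eq = ⊥-elim (t-odd u {a} {b} a-even b-even eq)
    semiregular u a b a-even b-even false true  eq = ⊥-elim (t-odd u {b} {a} b-even a-even λ z → sym (eq z))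

proposition5p3 : (n : ℕ) → 5 ≤ n →
    Σ[ S ∈ List (Sym n) ] IsCayleySet S × CayleyIndex S 2 × RegularAltZ2 n S
proposition5p3 n 5≤n with ℕ.m≤n⇒∃[o]m+o≡n 5≤n
... | m , refl = S m , isCayleySet m , cayleyIndex m , regular m
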